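{- Let $n\geq 20$ be an even integer that is not a power of two. Then there is an extremal overlap-free word of length $n$ over $\{\mathtt{0},\mathtt{1}\}$.
   Context: An overlap is a word $axaxa$ with $a$ a letter, $x$ possibly empty; a word is overlap-free if it has no overlap as a factor. An extension of a word $w$ over $\{\mathtt{0},\mathtt{1}\}$ is a word $w'aw''$ with $a\in\{\mathtt{0},\mathtt{1}\}$ and $w'w''=w$; $w$ is extremal overlap-free if it is overlap-free and every extension of $w$ contains an overlap. -}

module Defs where

open import Data.Bool using (Bool)
open import Data.List using (List; []; _∷_; _++_; length)
open import Data.Nat using (ℕ; _^_)
open import Data.Product using (Σ; ∃; _×_)
open import Relation.Binary.PropositionalEquality using (_≡_)
open import Relation.Nullary using (¬_)

-- Binary words: letters 0,1 represented by Bool (false = 0, true = 1).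
Word : Set
Word = List Bool

Factor : Word → Word → Set
Factor f w = ∃ λ u → ∃ λ v → w ≡ u ++ f ++ v

IsOverlap : Word → Set
IsOverlap o = ∃ λ (a : Bool) → ∃ λ (x : Word) → o ≡ a ∷ x ++ a ∷ x ++ a ∷ []

ContainsOverlap : Word → Set
ContainsOverlap w = ∃ λ o → IsOverlap o × Factor o w

OverlapFree : Word → Set
OverlapFree w = ¬ ContainsOverlap w

Extension : Word → Word → Set
Extension e w = ∃ λ (w' : Word) → ∃ λ (w'' : Word) → ∃ λ (a : Bool) →
  (w' ++ w'' ≡ w) × (e ≡ w' ++ a ∷ w'')

ExtremalOverlapFree : Word → Set
ExtremalOverlapFree w = OverlapFree w × (∀ e → Extension e w → ContainsOverlap e)

IsPowerOfTwo : ℕ → Set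
IsPowerOfTwo n = ∃ λ k → n ≡ 2 ^ k

module Submission where

-- Write n = 2m; m ≥ 10 is not a power of two either.  The word is  twist U = μ U
-- with its first and last letters complemented, where μ is the Thue–Morse morphism and U
-- is an overlap-free word of length m framed by one of six admissible 8-letter prefixes
-- and one of six admissible 8-letter suffixes.
--   * Positional overlaps (decidable) and a sound overlap search, used to discharge all
--     statements about concrete words by computation.
--   * Thue's argument, adapted to the two complemented end letters: an overlap of twist U
--     comes from an overlap of U or lies within eleven letters of an end; the admissible
--     ends exclude the latter, so twist U is overlap-free.
--   * Framed overlap-free words of every length m ≥ 10 that is not a power of two:
--     explicit words for m ≤ 31, and beyond by strong induction, cutting 0, 5 or 7
--     letters off twisted images of shorter ones (a parity invariant on the classes of the
--     two ends tells where an odd length may be cut).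
--   * Extremality: inserting a letter near either end of twist U creates an overlap by a
--     finite check on the admissible ends; elsewhere it falls into the middle of the image
--     μ g of a 5-letter factor g of U, where a check over all 5-letter words applies.

open import Defs
open import Data.Bool using (Bool; true; false; not)
open import Data.Bool using () renaming (false to 𝟎; true to 𝟏)
open import Data.Bool.Properties using (not-involutive; not-injective; not-¬) renaming (_≟_ to _≟ᵇ_)
open import Data.Empty using (⊥; ⊥-elim)
open import Data.List using ([]; _∷_; _++_; length; take; drop)
open import Data.List.Properties using (length-++; ++-assoc; ++-identityʳ; take++drop≡id; length-take; length-drop)
open import Data.Maybe using (Maybe; just; nothing; from-just; _<∣>_; zip; zipWith) renaming (map to mapᴹ)
open import Data.Nat using (ℕ; zero; suc; _+_; _*_; _^_; _∸_; _⊓_; _≤_; _<_; z≤n; s≤s; _≤?_; _<?_)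
open import Data.Nat.Induction using (<-rec)
open import Data.Nat.Properties
open import Data.Nat.Tactic.RingSolver using (solve-∀)
open import Data.Product using (Σ; ∃; _×_; _,_; proj₁; proj₂)
open import Data.Sum using (_⊎_; inj₁; inj₂; [_,_]′; map₂)
open import Data.Unit using (⊤; tt)
open import Function using (_∘_)
open import Relation.Binary.PropositionalEquality
open import Relation.Nullary using (¬_; Dec; yes; no)
open import Relation.Nullary.Decidable using (_×-dec_; map′; False; toWitnessFalse)

-- The letter at position k.
at : Word → ℕ → Bool
at []       _       = false
at (x ∷ xs) zero    = x
at (x ∷ xs) (suc k) = at xs k

OverlapAt : (ℕ → Bool) → ℕ → ℕ → ℕ → Set
OverlapAt f L i p = (1 ≤ p) × (i + (p + p) < L) × (∀ k → k ≤ p → f (i + k) ≡ f (i + k + p))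

HasOverlap : (ℕ → Bool) → ℕ → Set
HasOverlap f L = Σ ℕ λ i → Σ ℕ λ p → OverlapAt f L i p

-- Overlap-freeness phrased through positions; it implies OverlapFree (see below)
-- and, unlike it, is decidable by a bounded search.
NoOverlap : Word → Set
NoOverlap w = ¬ HasOverlap (at w) (length w)

overlapAt? : ∀ f L i p → Dec (OverlapAt f L i p)
overlapAt? f L i p = (1 ≤? p) ×-dec (suc (i + (p + p)) ≤? L) ×-dec
  map′ (λ h k k≤p → h (s≤s k≤p)) (λ h {k} k<1+p → h k (≤-pred k<1+p))
       (allUpTo? (λ k → f (i + k) ≟ᵇ f (i + k + p)) (suc p))

hasOverlap? : ∀ f L → Dec (HasOverlap f L)
hasOverlap? f L = map′ forget remember (anyUpTo? (λ i → anyUpTo? (overlapAt? f L i) L) L)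
  where
  forget : (∃ λ i → i < L × ∃ λ p → p < L × OverlapAt f L i p) → HasOverlap f L
  forget (i , _ , p , _ , o) = i , p , o
  remember : HasOverlap f L → ∃ λ i → i < L × ∃ λ p → p < L × OverlapAt f L i p
  remember (i , p , o@(_ , bound , _)) =
    i , ≤-<-trans (m≤m+n i _) bound , p , ≤-<-trans (≤-trans (m≤m+n p p) (m≤n+m _ i)) bound , o

refute : ∀ f L {check : False (hasOverlap? f L)} → ¬ HasOverlap f L
refute f L {check} = toWitnessFalse check

at-++ˡ : ∀ (xs ys : Word) k → k < length xs → at (xs ++ ys) k ≡ at xs k
at-++ˡ (x ∷ xs) ys zero    _          = refl
at-++ˡ (x ∷ xs) ys (suc k) (s≤s k<n) = at-++ˡ xs ys k k<n

at-++ʳ : ∀ (xs ys : Word) k → at (xs ++ ys) (length xs + k) ≡ at ys k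
at-++ʳ []       ys k = refl
at-++ʳ (x ∷ xs) ys k = at-++ʳ xs ys k

at-infix : ∀ (u o v : Word) k → k < length o → at (u ++ o ++ v) (length u + k) ≡ at o k
at-infix u o v k k<o = trans (at-++ʳ u (o ++ v) k) (at-++ˡ o v k k<o)

length-infix : ∀ (u o v : Word) → length (u ++ o ++ v) ≡ length u + (length o + length v)
length-infix u o v = trans (length-++ u) (cong (length u +_) (length-++ o))

compared-in-window : ∀ {i p k L} → i + (p + p) < L → k ≤ p → i + k + p < L
compared-in-window {i} {p} {k} bound k≤p =
  ≤-<-trans (subst (_≤ i + (p + p)) (sym (+-assoc i k p)) (+-monoʳ-≤ i (+-monoˡ-≤ p k≤p))) bound

compared-in-window′ : ∀ {i p k L} → i + (p + p) < L → k ≤ p → i + k < L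
compared-in-window′ {i} {p} {k} bound k≤p = ≤-<-trans (m≤m+n (i + k) p) (compared-in-window bound k≤p)

shift-assoc : ∀ d i k p → d + (i + k + p) ≡ d + i + k + p
shift-assoc = solve-∀

shiftOverlap : ∀ {f h : ℕ → Bool} {L L′} d → (∀ n → n < L → f n ≡ h (d + n)) → d + L ≤ L′ →
               HasOverlap f L → HasOverlap h L′
shiftOverlap {f} {h} {L} {L′} d embed fits (i , p , p≥1 , bound , periodic) = d + i , p , p≥1 , bound′ , periodic′
  where
  bound′ : d + i + (p + p) < L′
  bound′ = <-≤-trans (subst (_< d + L) (sym (+-assoc d i (p + p))) (+-monoʳ-< d bound)) fits
  periodic′ : ∀ k → k ≤ p → h (d + i + k) ≡ h (d + i + k + p)
  periodic′ k k≤p = begin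
    h (d + i + k)        ≡⟨ cong h (+-assoc d i k) ⟩
    h (d + (i + k))      ≡⟨ sym (embed (i + k) (compared-in-window′ bound k≤p)) ⟩
    f (i + k)            ≡⟨ periodic k k≤p ⟩
    f (i + k + p)        ≡⟨ embed (i + k + p) (compared-in-window bound k≤p) ⟩
    h (d + (i + k + p))  ≡⟨ cong h (shift-assoc d i k p) ⟩
    h (d + i + k + p)    ∎
    where open ≡-Reasoning

unshiftOverlap : ∀ {f h : ℕ → Bool} {L} d i p → (∀ n → n < L → f n ≡ h (d + n)) →
                 OverlapAt h (d + L) (d + i) p → OverlapAt f L i p
unshiftOverlap {f} {h} {L} d i p embed (p≥1 , bound , periodic) = p≥1 , bound′ , periodic′
  where
  bound′ : i + (p + p) < L
  bound′ = +-cancelˡ-< d _ _ (subst (_< d + L) (+-assoc d i (p + p)) bound)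
  periodic′ : ∀ k → k ≤ p → f (i + k) ≡ f (i + k + p)
  periodic′ k k≤p = begin
    f (i + k)            ≡⟨ embed (i + k) (compared-in-window′ bound′ k≤p) ⟩
    h (d + (i + k))      ≡⟨ cong h (sym (+-assoc d i k)) ⟩
    h (d + i + k)        ≡⟨ periodic k k≤p ⟩
    h (d + i + k + p)    ≡⟨ cong h (sym (shift-assoc d i k p)) ⟩
    h (d + (i + k + p))  ≡⟨ sym (embed (i + k + p) (compared-in-window bound′ k≤p)) ⟩
    f (i + k + p)        ∎
    where open ≡-Reasoning

noOverlap-infix : ∀ (x y z : Word) → NoOverlap (x ++ y ++ z) → NoOverlap y
noOverlap-infix x y z none ov = none (shiftOverlap {h = at (x ++ y ++ z)} (length x) embed fits ov)
  where
  embed : ∀ n → n < length y → at y n ≡ at (x ++ y ++ z) (length x + n)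
  embed n n<y = sym (at-infix x y z n n<y)
  fits : length x + length y ≤ length (x ++ y ++ z)
  fits = subst (length x + length y ≤_) (sym (length-infix x y z)) (+-monoʳ-≤ (length x) (m≤m+n _ _))

overlap-periodic : ∀ (a : Bool) (x : Word) k → k ≤ suc (length x) →
                   at (a ∷ x ++ a ∷ x ++ a ∷ []) k ≡ at (a ∷ x ++ a ∷ x ++ a ∷ []) (k + suc (length x))
overlap-periodic a x k k≤p with m≤n⇒m<n∨m≡n k≤p
... | inj₁ k<p = begin
  at (y ++ y ++ a ∷ []) k             ≡⟨ at-++ˡ y _ k k<p ⟩
  at y k                              ≡⟨ sym (at-++ˡ y (a ∷ []) k k<p) ⟩
  at (y ++ a ∷ []) k                  ≡⟨ sym (at-++ʳ y (y ++ a ∷ []) k) ⟩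
  at (y ++ y ++ a ∷ []) (length y + k) ≡⟨ cong (at (y ++ y ++ a ∷ [])) (+-comm (length y) k) ⟩
  at (y ++ y ++ a ∷ []) (k + length y) ∎
  where
  open ≡-Reasoning
  y = a ∷ x
... | inj₂ refl = begin
  at (y ++ y ++ a ∷ []) (length y)                 ≡⟨ cong (at (y ++ y ++ a ∷ [])) (sym (+-identityʳ (length y))) ⟩
  at (y ++ y ++ a ∷ []) (length y + 0)             ≡⟨ at-infix y y (a ∷ []) 0 (s≤s z≤n) ⟩
  a                                                ≡⟨ sym (at-infix y (a ∷ []) [] 0 (s≤s z≤n)) ⟩
  at (y ++ a ∷ []) (length y + 0)                  ≡⟨ cong (at (y ++ a ∷ [])) (+-identityʳ (length y)) ⟩
  at (y ++ a ∷ []) (length y)                      ≡⟨ sym (at-++ʳ y (y ++ a ∷ []) (length y)) ⟩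
  at (y ++ y ++ a ∷ []) (length y + length y)      ∎
  where
  open ≡-Reasoning
  y = a ∷ x

length-overlap : ∀ (a : Bool) x → length (a ∷ x ++ a ∷ x ++ a ∷ []) ≡ suc (suc (length x) + suc (length x))
length-overlap a x rewrite length-++ x {a ∷ x ++ a ∷ []} | length-++ x {a ∷ []} = cong suc (arith (length x))
  where
  arith : ∀ n → n + suc (n + 1) ≡ suc (n + suc n)
  arith = solve-∀

containsOverlap⇒hasOverlap : ∀ w → ContainsOverlap w → HasOverlap (at w) (length w)
containsOverlap⇒hasOverlap w (o , (a , x , refl) , u , v , refl) =
  shiftOverlap {h = at (u ++ o ++ v)} (length u) embed fits (0 , suc (length x) , s≤s z≤n , inside , periodic)
  where
  embed : ∀ n → n < length o → at o n ≡ at (u ++ o ++ v) (length u + n)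
  embed n n<o = sym (at-infix u o v n n<o)
  fits : length u + length o ≤ length (u ++ o ++ v)
  fits = subst (length u + length o ≤_) (sym (length-infix u o v)) (+-monoʳ-≤ (length u) (m≤m+n _ _))
  inside : suc (length x) + suc (length x) < length o
  inside = ≤-reflexive (sym (length-overlap a x))
  periodic : ∀ k → k ≤ suc (length x) → at o k ≡ at o (k + suc (length x))
  periodic = overlap-periodic a x

noOverlap⇒overlapFree : ∀ w → NoOverlap w → OverlapFree w
noOverlap⇒overlapFree w none c = none (containsOverlap⇒hasOverlap w c)

stripPrefix : (o w : Word) → Maybe (∃ λ v → w ≡ o ++ v)
stripPrefix []      w       = just (w , refl)
stripPrefix (x ∷ o) []      = nothing
stripPrefix (x ∷ o) (y ∷ w) with x ≟ᵇ y
... | no _     = nothing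
... | yes refl = mapᴹ (λ { (v , eq) → v , cong (x ∷_) eq }) (stripPrefix o w)

overlapWith : (a : Bool) (x w : Word) → Maybe (∃ λ o → IsOverlap o × ∃ λ v → a ∷ w ≡ o ++ v)
overlapWith a x w =
  mapᴹ (λ { (v , eq) → _ , (a , x , refl) , v , eq }) (stripPrefix (a ∷ x ++ a ∷ x ++ a ∷ []) (a ∷ w))

overlapPrefix : (a : Bool) (w : Word) → ℕ → Maybe (∃ λ o → IsOverlap o × ∃ λ v → a ∷ w ≡ o ++ v)
overlapPrefix a w zero    = overlapWith a [] w
overlapPrefix a w (suc n) = overlapWith a (take (suc n) w) w <∣> overlapPrefix a w n

findOverlap : (w : Word) → Maybe (ContainsOverlap w)
findOverlap []      = nothing
findOverlap (a ∷ w) = mapᴹ atFront (overlapPrefix a w (length w)) <∣> mapᴹ later (findOverlap w)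
  where
  atFront : (∃ λ o → IsOverlap o × ∃ λ v → a ∷ w ≡ o ++ v) → ContainsOverlap (a ∷ w)
  atFront (o , ov , v , eq) = o , ov , [] , v , eq
  later : ContainsOverlap w → ContainsOverlap (a ∷ w)
  later (o , ov , u , v , eq) = o , ov , a ∷ u , v , cong (a ∷_) eq

everyUpTo : {P : ℕ → Set} → (∀ t → Maybe (P t)) → ∀ n → Maybe (∀ t → t ≤ n → P t)
everyUpTo search zero    = mapᴹ (λ p₀ → λ { zero _ → p₀ }) (search zero)
everyUpTo search (suc n) =
  zipWith (λ p₀ rest → λ { zero _ → p₀ ; (suc t) (s≤s t≤n) → rest t t≤n }) (search zero) (everyUpTo (search ∘ suc) n)

everyLetter : {P : Bool → Set} → (∀ a → Maybe (P a)) → Maybe (∀ a → P a)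
everyLetter search = zipWith (λ p₀ p₁ → λ { false → p₀ ; true → p₁ }) (search false) (search true)

everyWord : {P : Word → Set} → (∀ w → Maybe (P w)) → ∀ n → Maybe (∀ w → length w ≡ n → P w)
everyWord search zero    = mapᴹ (λ p → λ { [] _ → p }) (search [])
everyWord search (suc n) =
  mapᴹ (λ h → λ { (a ∷ w) e → h a w (suc-injective e) }) (everyLetter (λ a → everyWord (search ∘ (a ∷_)) n))

μ : Word → Word
μ []       = []
μ (x ∷ xs) = x ∷ not x ∷ μ xs

flipHead : Word → Word
flipHead []       = []
flipHead (x ∷ xs) = not x ∷ xs

flipLast : Word → Word
flipLast []           = []
flipLast (x ∷ [])     = not x ∷ []
flipLast (x ∷ y ∷ xs) = x ∷ flipLast (y ∷ xs)

twist : Word → Word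
twist v = flipHead (flipLast (μ v))

NonEmpty : Word → Set
NonEmpty []      = ⊥
NonEmpty (_ ∷ _) = ⊤

μ-++ : ∀ xs ys → μ (xs ++ ys) ≡ μ xs ++ μ ys
μ-++ []       ys = refl
μ-++ (x ∷ xs) ys = cong (λ w → x ∷ not x ∷ w) (μ-++ xs ys)

length-μ : ∀ xs → length (μ xs) ≡ length xs + length xs
length-μ []       = refl
length-μ (x ∷ xs) = cong suc (trans (cong suc (length-μ xs)) (sym (+-suc (length xs) (length xs))))

length-flipLast : ∀ xs → length (flipLast xs) ≡ length xs
length-flipLast []           = refl
length-flipLast (x ∷ [])     = refl
length-flipLast (x ∷ y ∷ xs) = cong suc (length-flipLast (y ∷ xs))

length-flipHead : ∀ xs → length (flipHead xs) ≡ length xs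
length-flipHead []       = refl
length-flipHead (x ∷ xs) = refl

length-twist : ∀ v → length (twist v) ≡ length v + length v
length-twist v = trans (length-flipHead (flipLast (μ v))) (trans (length-flipLast (μ v)) (length-μ v))

nonEmpty-length : ∀ xs → 1 ≤ length xs → NonEmpty xs
nonEmpty-length (x ∷ xs) _ = tt

nonEmpty-++ʳ : ∀ xs ys → NonEmpty ys → NonEmpty (xs ++ ys)
nonEmpty-++ʳ []       ys ne = ne
nonEmpty-++ʳ (x ∷ xs) ys ne = tt

nonEmpty-++ˡ : ∀ xs ys → NonEmpty xs → NonEmpty (xs ++ ys)
nonEmpty-++ˡ (x ∷ xs) ys _ = tt

nonEmpty-μ : ∀ xs → NonEmpty xs → NonEmpty (μ xs)
nonEmpty-μ (x ∷ xs) _ = tt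

flipLast-++ : ∀ xs ys → NonEmpty ys → flipLast (xs ++ ys) ≡ xs ++ flipLast ys
flipLast-++ []            ys       ne = refl
flipLast-++ (x ∷ [])      (y ∷ ys) ne = refl
flipLast-++ (x ∷ x′ ∷ xs) (y ∷ ys) ne = cong (x ∷_) (flipLast-++ (x′ ∷ xs) (y ∷ ys) ne)

flipHead-++ : ∀ xs ys → NonEmpty xs → flipHead (xs ++ ys) ≡ flipHead xs ++ ys
flipHead-++ (x ∷ xs) ys _ = refl

twist-++ : ∀ X Y Z → NonEmpty X → NonEmpty Z → twist (X ++ Y ++ Z) ≡ flipHead (μ X) ++ μ Y ++ flipLast (μ Z)
twist-++ X Y Z neX neZ = begin
  flipHead (flipLast (μ (X ++ Y ++ Z)))     ≡⟨ cong (flipHead ∘ flipLast) (trans (μ-++ X (Y ++ Z)) (cong (μ X ++_) (μ-++ Y Z))) ⟩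
  flipHead (flipLast (μ X ++ μ Y ++ μ Z))   ≡⟨ cong flipHead (flipLast-++ (μ X) (μ Y ++ μ Z) (nonEmpty-++ʳ (μ Y) (μ Z) neμZ)) ⟩
  flipHead (μ X ++ flipLast (μ Y ++ μ Z))   ≡⟨ cong (λ w → flipHead (μ X ++ w)) (flipLast-++ (μ Y) (μ Z) neμZ) ⟩
  flipHead (μ X ++ μ Y ++ flipLast (μ Z))   ≡⟨ flipHead-++ (μ X) _ (nonEmpty-μ X neX) ⟩
  flipHead (μ X) ++ μ Y ++ flipLast (μ Z)   ∎
  where
  open ≡-Reasoning
  neμZ = nonEmpty-μ Z neZ

at-μ-even : ∀ V x → x < length V → at (μ V) (x + x) ≡ at V x
at-μ-even (v ∷ V) zero    _         = refl
at-μ-even (v ∷ V) (suc x) (s≤s x<n) = trans (cong (at (not v ∷ μ V)) (+-suc x x)) (at-μ-even V x x<n)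

at-μ-odd : ∀ V x → x < length V → at (μ V) (suc (x + x)) ≡ not (at V x)
at-μ-odd (v ∷ V) zero    _         = refl
at-μ-odd (v ∷ V) (suc x) (s≤s x<n) = trans (cong (λ k → at (not v ∷ μ V) (suc k)) (+-suc x x)) (at-μ-odd V x x<n)

at-flipLast-last : ∀ w x → length w ≡ suc x → at (flipLast w) x ≡ not (at w x)
at-flipLast-last (a ∷ [])     zero    _ = refl
at-flipLast-last (a ∷ b ∷ w)  (suc x) e = at-flipLast-last (b ∷ w) x (suc-injective e)

at-flipLast-other : ∀ w n → suc n < length w → at (flipLast w) n ≡ at w n
at-flipLast-other (a ∷ [])    n       (s≤s ())
at-flipLast-other (a ∷ b ∷ w) zero    _         = refl
at-flipLast-other (a ∷ b ∷ w) (suc n) (s≤s n<w) = at-flipLast-other (b ∷ w) n n<w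

at-flipHead-suc : ∀ w n → at (flipHead w) (suc n) ≡ at w (suc n)
at-flipHead-suc []      n = refl
at-flipHead-suc (x ∷ w) n = refl

double-< : ∀ {x m} → x < m → suc (x + x) < m + m
double-< {x} x<m = ≤-trans (≤-reflexive (cong suc (sym (+-suc x x)))) (+-mono-≤ x<m x<m)

twist-interior : ∀ V n → suc (suc n) < length V + length V → at (twist V) (suc n) ≡ at (μ V) (suc n)
twist-interior V n n<last =
  trans (at-flipHead-suc (flipLast (μ V)) n) (at-flipLast-other (μ V) (suc n) (subst (suc (suc n) <_) (sym (length-μ V)) n<last))

-- The first two letters of twist V agree, because the first one is flipped.
twist-first-pair : ∀ V → 2 ≤ length V → at (twist V) 0 ≡ at (twist V) 1
twist-first-pair (a ∷ [])    (s≤s ())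
twist-first-pair (a ∷ b ∷ V) _ = refl

module TwistFacts (V : Word) where
  m = length V

  even-pos : ∀ x → 1 ≤ x → x < m → at (twist V) (x + x) ≡ at V x
  even-pos (suc x) _ x<m = trans (twist-interior V (x + suc x) (double-< x<m)) (at-μ-even V (suc x) x<m)

  odd-pos : ∀ x → suc x < m → at (twist V) (suc (x + x)) ≡ not (at V x)
  odd-pos x x+1<m = trans (twist-interior V (x + x) (<-trans (n<1+n _) (subst (λ k → suc (suc k) < m + m) (+-suc x x) (double-< x+1<m))))
                          (at-μ-odd V x (<-trans (n<1+n x) x+1<m))

  -- The last two letters agree, because the last one is flipped.
  last-pair : ∀ m′ → m ≡ suc m′ → 1 ≤ m′ → at (twist V) (suc (m′ + m′)) ≡ at (twist V) (m′ + m′)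
  last-pair m′ m≡1+m′ 1≤m′ = begin
    at (twist V) (suc (m′ + m′))     ≡⟨ at-flipHead-suc (flipLast (μ V)) (m′ + m′) ⟩
    at (flipLast (μ V)) (suc (m′ + m′)) ≡⟨ at-flipLast-last (μ V) _ (trans (length-μ V) (trans (cong₂ _+_ m≡1+m′ m≡1+m′) (cong suc (+-suc m′ m′)))) ⟩
    not (at (μ V) (suc (m′ + m′)))   ≡⟨ cong not (at-μ-odd V m′ m′<m) ⟩
    not (not (at V m′))              ≡⟨ not-involutive _ ⟩
    at V m′                          ≡⟨ sym (even-pos m′ 1≤m′ m′<m) ⟩
    at (twist V) (m′ + m′)           ∎
    where
    open ≡-Reasoning
    m′<m : m′ < m
    m′<m = subst (m′ <_) (sym m≡1+m′) ≤-refl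

parity : ∀ n → Σ ℕ λ r → (n ≡ r + r) ⊎ (n ≡ suc (r + r))
parity zero    = 0 , inj₁ refl
parity (suc n) with parity n
... | r , inj₁ n≡2r   = r , inj₂ (cong suc n≡2r)
... | r , inj₂ n≡2r+1 = suc r , inj₁ (cong suc (trans n≡2r+1 (sym (+-suc r r))))

halve-< : ∀ {a b} → a + a < b + b → a < b
halve-< {a} {b} 2a<2b with a <? b
... | yes a<b = a<b
... | no  a≮b = ⊥-elim (<⇒≱ 2a<2b (+-mono-≤ (≮⇒≥ a≮b) (≮⇒≥ a≮b)))

halve-≤ : ∀ {a b} → a + a ≤ b + b → a ≤ b
halve-≤ {a} {b} 2a≤2b with b <? a
... | yes b<a = ⊥-elim (<⇒≱ (+-mono-< b<a b<a) 2a≤2b)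
... | no  b≮a = ≮⇒≥ b≮a

positive-half : ∀ {q} → 1 ≤ q + q → 1 ≤ q
positive-half {suc q} _ = s≤s z≤n

≤-by : ∀ a {b} c → b ≡ a + c → a ≤ b
≤-by a c b≡a+c = subst (a ≤_) (sym b≡a+c) (m≤m+n a c)

complement-step : ∀ {x y z : Bool} → not x ≡ z → y ≡ not z → y ≡ x
complement-step {false} refl refl = refl
complement-step {true}  refl refl = refl

2x+1≤2[x+1] : ∀ x → suc (x + x) ≤ suc x + suc x
2x+1≤2[x+1] x = s≤s (≤-trans (n≤1+n _) (≤-reflexive (sym (+-suc x x))))

2x≤2[x+1] : ∀ x → x + x ≤ suc x + suc x
2x≤2[x+1] x = ≤-trans (n≤1+n _) (2x+1≤2[x+1] x)

constant-run : (g : ℕ → Bool) → ∀ x n → (∀ t → t < n → g (x + t) ≡ g (x + suc t)) → g x ≡ g (x + n)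
constant-run g x zero    steps = cong g (sym (+-identityʳ x))
constant-run g x (suc n) steps = trans (constant-run g x n (λ t t<n → steps t (m<n⇒m<1+n t<n))) (steps n ≤-refl)

periodic-between : ∀ {f : ℕ → Bool} {i p} → (∀ k → k ≤ p → f (i + k) ≡ f (i + k + p)) →
                   ∀ n → i ≤ n → n ≤ i + p → f n ≡ f (n + p)
periodic-between {f} {i} {p} periodic n i≤n n≤i+p =
  subst (λ k → f k ≡ f (k + p)) (m+[n∸m]≡n i≤n)
        (periodic (n ∸ i) (+-cancelˡ-≤ i _ _ (subst (_≤ i + p) (sym (m+[n∸m]≡n i≤n)) n≤i+p)))

cube-overlap : ∀ {g : ℕ → Bool} {m} r → g r ≡ g (suc r) → g (suc r) ≡ g (suc (suc r)) → suc (suc r) < m → HasOverlap g m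
cube-overlap {g} {m} r e₁ e₂ r+2<m = r , 1 , s≤s z≤n , subst (_< m) (sym (+-comm r 2)) r+2<m , periodic
  where
  arith₀ : ∀ r → r + 0 + 1 ≡ suc r
  arith₀ = solve-∀
  arith₁ : ∀ r → r + 1 + 1 ≡ suc (suc r)
  arith₁ = solve-∀
  periodic : ∀ k → k ≤ 1 → g (r + k) ≡ g (r + k + 1)
  periodic zero       _ = begin
    g (r + 0)      ≡⟨ cong g (+-identityʳ r) ⟩
    g r            ≡⟨ e₁ ⟩
    g (suc r)      ≡⟨ cong g (sym (arith₀ r)) ⟩
    g (r + 0 + 1)  ∎
    where open ≡-Reasoning
  periodic (suc zero) _ = begin
    g (r + 1)          ≡⟨ cong g (+-comm r 1) ⟩
    g (suc r)          ≡⟨ e₂ ⟩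
    g (suc (suc r))    ≡⟨ cong g (sym (arith₁ r)) ⟩
    g (r + 1 + 1)      ∎
    where open ≡-Reasoning
  periodic (suc (suc k)) (s≤s ())

-- Overlaps of a sequence f that coincides with the Thue–Morse image μ g on the positions
-- 1 … 2m−2 (even positions 2x carry g x, odd positions 2x+1 carry not (g x)).
-- Thue's argument: an overlap of f inside that range yields an overlap of g.
module MorphicOverlaps (f g : ℕ → Bool) (m : ℕ)
  (even-pos : ∀ x → 1 ≤ x → x < m → f (x + x) ≡ g x)
  (odd-pos  : ∀ x → suc x < m → f (suc (x + x)) ≡ not (g x))
  where

  -- An odd shift 2q+1 that fixes the letters at 2x+1 and 2x+2 forces g x = g (x + 1):
  -- both letters are then compared with the two halves of the block of g (x + q + 1).
  odd-shift-step : ∀ q x → f (suc (x + x)) ≡ f (suc (x + x) + suc (q + q)) →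
                   f (suc x + suc x) ≡ f (suc x + suc x + suc (q + q)) →
                   suc (suc (x + q)) < m → g x ≡ g (suc x)
  odd-shift-step q x e₁ e₂ y+1<m = sym (complement-step {g x} {g (suc x)} {g y} left right)
    where
    y = suc (x + q)
    x+1<m : suc x < m
    x+1<m = ≤-trans (s≤s (s≤s (≤-trans (m≤m+n x q) (n≤1+n _)))) y+1<m
    arith₁ : ∀ x q → suc (x + x) + suc (q + q) ≡ suc (x + q) + suc (x + q)
    arith₁ = solve-∀
    arith₂ : ∀ x q → suc x + suc x + suc (q + q) ≡ suc (suc (x + q) + suc (x + q))
    arith₂ = solve-∀
    left : not (g x) ≡ g y
    left = trans (sym (odd-pos x x+1<m)) (trans e₁ (trans (cong f (arith₁ x q)) (even-pos y (s≤s z≤n) (<-trans (n<1+n y) y+1<m))))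
    right : g (suc x) ≡ not (g y)
    right = trans (sym (even-pos (suc x) (s≤s z≤n) x+1<m)) (trans e₂ (trans (cong f (arith₂ x q)) (odd-pos y y+1<m)))

  -- Start 2r, period 2q: the overlap is the μ-image of the overlap (r, q) of g.
  even-start-even-period : ∀ r q → 1 ≤ r → 1 ≤ q → suc (r + r + ((q + q) + (q + q))) < m + m →
                           (∀ k → k ≤ q + q → f (r + r + k) ≡ f (r + r + k + (q + q))) → HasOverlap g m
  even-start-even-period r q r≥1 q≥1 fits periodic = r , q , q≥1 , bound , periodic′
    where
    arith₁ : ∀ r q → suc (r + r + ((q + q) + (q + q))) ≡ suc ((r + (q + q)) + (r + (q + q)))
    arith₁ = solve-∀
    arith₂ : ∀ r q → (r + q) + (r + q) ≡ r + r + (q + q)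
    arith₂ = solve-∀
    arith₃ : ∀ r k q → (r + k) + (r + k) + (q + q) ≡ (r + k + q) + (r + k + q)
    arith₃ = solve-∀
    bound : r + (q + q) < m
    bound = halve-< (<-trans (n<1+n _) (subst (_< m + m) (arith₁ r q) fits))
    periodic′ : ∀ k → k ≤ q → g (r + k) ≡ g (r + k + q)
    periodic′ k k≤q = begin
      g (r + k)                        ≡⟨ sym (even-pos (r + k) (≤-trans r≥1 (m≤m+n r k)) (≤-<-trans (m≤m+n _ q) far)) ⟩
      f ((r + k) + (r + k))            ≡⟨ periodic-between {f} periodic _ (+-mono-≤ (m≤m+n r k) (m≤m+n r k)) within ⟩
      f ((r + k) + (r + k) + (q + q))  ≡⟨ cong f (arith₃ r k q) ⟩
      f ((r + k + q) + (r + k + q))    ≡⟨ even-pos (r + k + q) (≤-trans r≥1 (≤-trans (m≤m+n r k) (m≤m+n _ q))) far ⟩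
      g (r + k + q)                    ∎
      where
      open ≡-Reasoning
      far : r + k + q < m
      far = ≤-<-trans (≤-trans (+-monoˡ-≤ q (+-monoʳ-≤ r k≤q)) (≤-reflexive (+-assoc r q q))) bound
      within : (r + k) + (r + k) ≤ r + r + (q + q)
      within = ≤-trans (+-mono-≤ (+-monoʳ-≤ r k≤q) (+-monoʳ-≤ r k≤q)) (≤-reflexive (arith₂ r q))

  -- Start 2r+1, period 2q: again the image of the overlap (r, q) of g, read on odd positions.
  odd-start-even-period : ∀ r q → 1 ≤ q → suc (suc (r + r) + ((q + q) + (q + q))) < m + m →
                          (∀ k → k ≤ q + q → f (suc (r + r) + k) ≡ f (suc (r + r) + k + (q + q))) → HasOverlap g m
  odd-start-even-period r q q≥1 fits periodic = r , q , q≥1 , <-trans (n<1+n _) room , periodic′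
    where
    arith₁ : ∀ r q → suc (suc (r + r) + ((q + q) + (q + q))) ≡ suc (r + (q + q)) + suc (r + (q + q))
    arith₁ = solve-∀
    arith₂ : ∀ r q → (r + q) + (r + q) ≡ r + r + (q + q)
    arith₂ = solve-∀
    arith₃ : ∀ r k q → suc ((r + k) + (r + k)) + (q + q) ≡ suc ((r + k + q) + (r + k + q))
    arith₃ = solve-∀
    room : suc (r + (q + q)) < m
    room = halve-< (subst (_< m + m) (arith₁ r q) fits)
    periodic′ : ∀ k → k ≤ q → g (r + k) ≡ g (r + k + q)
    periodic′ k k≤q = not-injective (begin
      not (g (r + k))                        ≡⟨ sym (odd-pos (r + k) (≤-<-trans (s≤s (m≤m+n _ q)) far)) ⟩
      f (suc ((r + k) + (r + k)))            ≡⟨ periodic-between {f} periodic _ (s≤s (+-mono-≤ (m≤m+n r k) (m≤m+n r k))) within ⟩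
      f (suc ((r + k) + (r + k)) + (q + q))  ≡⟨ cong f (arith₃ r k q) ⟩
      f (suc ((r + k + q) + (r + k + q)))    ≡⟨ odd-pos (r + k + q) far ⟩
      not (g (r + k + q))                    ∎)
      where
      open ≡-Reasoning
      far : suc (r + k + q) < m
      far = ≤-<-trans (s≤s (≤-trans (+-monoˡ-≤ q (+-monoʳ-≤ r k≤q)) (≤-reflexive (+-assoc r q q)))) room
      within : suc ((r + k) + (r + k)) ≤ suc (r + r) + (q + q)
      within = s≤s (≤-trans (+-mono-≤ (+-monoʳ-≤ r k≤q) (+-monoʳ-≤ r k≤q)) (≤-reflexive (arith₂ r q)))

  -- Start 2r, odd period 2q+1: odd-shift-step applies all along, so g is constant on
  -- r … r+q, while the two ends of the overlap force g r ≠ g (r + q).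
  even-start-odd-period : ∀ r q → 1 ≤ r → suc (r + r + (suc (q + q) + suc (q + q))) < m + m →
                          ¬ (∀ k → k ≤ suc (q + q) → f (r + r + k) ≡ f (r + r + k + suc (q + q)))
  even-start-odd-period r q r≥1 fits periodic = not-¬ refl (trans (sym run) ends)
    where
    arith₁ : ∀ r q → suc (suc (r + r + (suc (q + q) + suc (q + q)))) ≡ suc (suc (r + (q + q))) + suc (suc (r + (q + q)))
    arith₁ = solve-∀
    arith₂ : ∀ r t → suc (r + t) + suc (r + t) ≡ (r + suc t) + (r + suc t)
    arith₂ = solve-∀
    arith₃ : ∀ r q → (r + q) + (r + q) ≡ r + r + (q + q)
    arith₃ = solve-∀
    arith₄ : ∀ r q → r + r + suc (q + q) ≡ suc ((r + q) + (r + q))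
    arith₄ = solve-∀
    room : suc (suc (r + (q + q))) ≤ m
    room = halve-≤ (subst (_≤ m + m) (arith₁ r q) fits)
    window = periodic-between {f} periodic
    step : ∀ t → t < q → g (r + t) ≡ g (r + suc t)
    step t t<q = trans (odd-shift-step q x (window _ (≤-trans inside (n≤1+n _)) (≤-trans (2x+1≤2[x+1] x) end))
                                           (window _ (≤-trans inside (2x≤2[x+1] x)) end) far)
                       (cong g (sym (+-suc r t)))
      where
      open ≤-Reasoning
      x = r + t
      inside : r + r ≤ x + x
      inside = +-mono-≤ (m≤m+n r t) (m≤m+n r t)
      end : suc x + suc x ≤ r + r + suc (q + q)
      end = begin
        suc x + suc x              ≡⟨ arith₂ r t ⟩
        (r + suc t) + (r + suc t)  ≤⟨ +-mono-≤ (+-monoʳ-≤ r t<q) (+-monoʳ-≤ r t<q) ⟩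
        (r + q) + (r + q)          ≡⟨ arith₃ r q ⟩
        r + r + (q + q)            ≤⟨ +-monoʳ-≤ (r + r) (n≤1+n _) ⟩
        r + r + suc (q + q)        ∎
      far : suc (suc (x + q)) < m
      far = begin-strict
        suc (suc (x + q))          <⟨ s≤s (s≤s (≤-reflexive (cong (_+ q) (sym (+-suc r t))))) ⟩
        suc (suc (r + suc t + q))  ≤⟨ s≤s (s≤s (+-monoˡ-≤ q (+-monoʳ-≤ r t<q))) ⟩
        suc (suc (r + q + q))      ≡⟨ cong (suc ∘ suc) (+-assoc r q q) ⟩
        suc (suc (r + (q + q)))    ≤⟨ room ⟩
        m                          ∎
    run : g r ≡ g (r + q)
    run = constant-run g r q step
    ends : g r ≡ not (g (r + q))
    ends = begin
      g r                          ≡⟨ sym (even-pos r r≥1 (≤-<-trans (m≤m+n r (q + q)) (<-trans (n<1+n _) room))) ⟩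
      f (r + r)                    ≡⟨ window (r + r) ≤-refl (m≤m+n _ _) ⟩
      f (r + r + suc (q + q))      ≡⟨ cong f (arith₄ r q) ⟩
      f (suc ((r + q) + (r + q)))  ≡⟨ odd-pos (r + q) (≤-trans (s≤s (s≤s (+-monoʳ-≤ r (m≤m+n q q)))) room) ⟩
      not (g (r + q))              ∎
      where open ≡-Reasoning

  -- Start 2r+1, odd period 2q+1: as before g is constant on r … r+q+1, while the two
  -- ends of the overlap force g (r + q + 1) ≠ g r.
  odd-start-odd-period : ∀ r q → suc (suc (r + r) + (suc (q + q) + suc (q + q))) < m + m →
                         ¬ (∀ k → k ≤ suc (q + q) → f (suc (r + r) + k) ≡ f (suc (r + r) + k + suc (q + q)))
  odd-start-odd-period r q fits periodic = not-¬ refl (trans run ends)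
    where
    arith₁ : ∀ r q → suc (suc (r + r) + (suc (q + q) + suc (q + q))) ≡ suc (suc (r + (q + q))) + suc (suc (r + (q + q)))
    arith₁ = solve-∀
    arith₂ : ∀ r q → suc (r + q) + suc (r + q) ≡ suc (r + r) + suc (q + q)
    arith₂ = solve-∀
    arith₃ : ∀ r q → suc (r + r) + suc (q + q) ≡ (r + suc q) + (r + suc q)
    arith₃ = solve-∀
    room : suc (suc (r + (q + q))) < m
    room = halve-< (subst (_< m + m) (arith₁ r q) fits)
    window = periodic-between {f} periodic
    step : ∀ t → t < suc q → g (r + t) ≡ g (r + suc t)
    step t (s≤s t≤q) = trans (odd-shift-step q x (window _ inside (≤-trans (2x+1≤2[x+1] x) end))
                                                (window _ (≤-trans inside (2x+1≤2[x+1] x)) end) far)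
                             (cong g (sym (+-suc r t)))
      where
      open ≤-Reasoning
      x = r + t
      inside : suc (r + r) ≤ suc (x + x)
      inside = s≤s (+-mono-≤ (m≤m+n r t) (m≤m+n r t))
      end : suc x + suc x ≤ suc (r + r) + suc (q + q)
      end = begin
        suc x + suc x                ≤⟨ +-mono-≤ (s≤s (+-monoʳ-≤ r t≤q)) (s≤s (+-monoʳ-≤ r t≤q)) ⟩
        suc (r + q) + suc (r + q)    ≡⟨ arith₂ r q ⟩
        suc (r + r) + suc (q + q)    ∎
      far : suc (suc (x + q)) < m
      far = begin-strict
        suc (suc (x + q))            ≤⟨ s≤s (s≤s (+-monoˡ-≤ q (+-monoʳ-≤ r t≤q))) ⟩
        suc (suc (r + q + q))        ≡⟨ cong (suc ∘ suc) (+-assoc r q q) ⟩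
        suc (suc (r + (q + q)))      <⟨ room ⟩
        m                            ∎
    run : g r ≡ g (r + suc q)
    run = constant-run g r (suc q) step
    ends : g (r + suc q) ≡ not (g r)
    ends = sym (begin
      not (g r)                          ≡⟨ sym (odd-pos r (≤-<-trans (s≤s (m≤m+n r (q + q))) (<-trans (n<1+n _) room))) ⟩
      f (suc (r + r))                    ≡⟨ window _ ≤-refl (m≤m+n _ _) ⟩
      f (suc (r + r) + suc (q + q))      ≡⟨ cong f (arith₃ r q) ⟩
      f ((r + suc q) + (r + suc q))      ≡⟨ even-pos (r + suc q) (≤-trans (s≤s z≤n) (≤-reflexive (sym (+-suc r q)))) near ⟩
      g (r + suc q)                      ∎)
      where
      open ≡-Reasoning
      near : r + suc q < m
      near = ≤-<-trans (≤-trans (≤-reflexive (+-suc r q)) (s≤s (+-monoʳ-≤ r (m≤m+n q q)))) (<-trans (n<1+n _) room)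

  interiorOverlap : ∀ i p → 1 ≤ i → 1 ≤ p → suc (i + (p + p)) < m + m →
                    (∀ k → k ≤ p → f (i + k) ≡ f (i + k + p)) → HasOverlap g m
  interiorOverlap i p i≥1 p≥1 fits periodic with parity i | parity p
  ... | r , inj₁ refl | q , inj₁ refl = even-start-even-period r q (positive-half i≥1) (positive-half p≥1) fits periodic
  ... | r , inj₂ refl | q , inj₁ refl = odd-start-even-period r q (positive-half p≥1) fits periodic
  ... | r , inj₁ refl | q , inj₂ refl = ⊥-elim (even-start-odd-period r q (positive-half i≥1) fits periodic)
  ... | r , inj₂ refl | q , inj₂ refl = ⊥-elim (odd-start-odd-period r q fits periodic)

OverlapNearEnd : (ℕ → Bool) → ℕ → Set
OverlapNearEnd f L = Σ ℕ λ i → Σ ℕ λ p → OverlapAt f L i p × (L ≤ i + 11)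

halve-≡ : ∀ {a b} → a + a ≡ b + b → a ≡ b
halve-≡ e = ≤-antisym (halve-≤ (≤-reflexive e)) (halve-≤ (≤-reflexive (sym e)))

-- Sums a + a are even (the library states this with 2 * a).
double≢odd : ∀ a b → a + a ≢ suc (b + b)
double≢odd a b e = even≢odd a b (trans (cong (a +_) (+-identityʳ a)) (trans e (cong (λ n → suc (b + n)) (sym (+-identityʳ b)))))

near-start : ∀ i x → suc x ≤ 11 → suc (i + x) ≤ i + 11
near-start i x x<11 = ≤-trans (≤-reflexive (sym (+-suc i x))) (+-monoʳ-≤ i x<11)

module BoundaryOverlaps (f g : ℕ → Bool) (m : ℕ)
  (even-pos : ∀ x → 1 ≤ x → x < m → f (x + x) ≡ g x)
  (odd-pos  : ∀ x → suc x < m → f (suc (x + x)) ≡ not (g x))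
  (first-pair : f 0 ≡ f 1)
  (m′ : ℕ) (m≡1+m′ : m ≡ suc m′)
  (last-pair : f (suc (m′ + m′)) ≡ f (m′ + m′))
  where
  open MorphicOverlaps f g m even-pos odd-pos

  -- A prefix overlap of even period 2(q+1) maps the equal first two letters onto the two
  -- differing letters of the block of g (q + 1).
  left-end-even-period : ∀ q → (suc q + suc q) + (suc q + suc q) < m + m →
                         ¬ (∀ k → k ≤ suc q + suc q → f (0 + k) ≡ f (0 + k + (suc q + suc q)))
  left-end-even-period q fits periodic = not-¬ refl (begin
    g (suc q)                ≡⟨ sym (even-pos (suc q) (s≤s z≤n) (<-trans (n<1+n _) block)) ⟩
    f (suc q + suc q)        ≡⟨ sym (periodic 0 z≤n) ⟩
    f 0                      ≡⟨ first-pair ⟩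
    f 1                      ≡⟨ periodic 1 (s≤s z≤n) ⟩
    f (suc (suc q + suc q))  ≡⟨ odd-pos (suc q) block ⟩
    not (g (suc q))          ∎)
    where
    open ≡-Reasoning
    block : suc (suc q) < m
    block = ≤-<-trans (s≤s (m≤n+m (suc q) q)) (halve-< fits)

  -- A prefix overlap of odd period 2q+1 ≥ 7 makes g r = g (r+1) = g (r+2) for r = 0.
  left-end-odd-period : ∀ n → let q = 3 + n in suc (q + q) + suc (q + q) < m + m →
                        (∀ k → k ≤ suc (q + q) → f (0 + k) ≡ f (0 + k + suc (q + q))) → HasOverlap g m
  left-end-odd-period n fits periodic =
    cube-overlap {g} 0 (odd-shift-step q 0 (periodic 1 (s≤s z≤n)) (periodic 2 (s≤s (s≤s z≤n))) (≤-trans (n≤1+n _) room₁))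
                   (odd-shift-step q 1 (periodic 3 (s≤s (s≤s (s≤s z≤n)))) (periodic 4 (s≤s (s≤s (s≤s (s≤s z≤n))))) room₁)
                   (≤-trans (s≤s (s≤s (s≤s z≤n))) room₁)
    where
    q = 3 + n
    arith : ∀ n → suc ((3 + n) + (3 + n)) ≡ suc (suc (suc (suc (3 + n)))) + n
    arith = solve-∀
    room₁ : suc (suc (suc (suc q))) ≤ m
    room₁ = ≤-trans (≤-by _ n (arith n)) (<⇒≤ (halve-< fits))

  left-end : ∀ p → OverlapAt f (m + m) 0 p → HasOverlap f 11 ⊎ HasOverlap g m
  left-end p (p≥1 , fits , periodic) with parity p
  ... | zero  , inj₁ refl = ⊥-elim (<⇒≱ p≥1 z≤n)
  ... | suc q , inj₁ refl = ⊥-elim (left-end-even-period q fits periodic)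
  ... | 0     , inj₂ refl = inj₁ (0 , 1 , p≥1 , ≤ᵇ⇒≤ 3 11 _ , periodic)
  ... | 1     , inj₂ refl = inj₁ (0 , 3 , p≥1 , ≤ᵇ⇒≤ 7 11 _ , periodic)
  ... | 2     , inj₂ refl = inj₁ (0 , 5 , p≥1 , ≤ᵇ⇒≤ 11 11 _ , periodic)
  ... | suc (suc (suc n)) , inj₂ refl = inj₂ (left-end-odd-period n fits periodic)

  -- An overlap of even period 2(q+1) ending at the last letter maps the block of
  -- g (r + q + 1) onto the equal last two letters.
  right-end-even-period : ∀ r q → m ≡ suc (r + (suc q + suc q)) →
    ¬ (∀ k → k ≤ suc q + suc q → f (suc (r + r) + k) ≡ f (suc (r + r) + k + (suc q + suc q)))
  right-end-even-period r q m≡ periodic = not-¬ refl (begin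
    g y                              ≡⟨ sym (even-pos y (≤-by 1 (r + q) (arith₁ r q)) (subst (y <_) (sym m≡) (≤-by (suc y) (suc q) (arith₂ r q)))) ⟩
    f (y + y)                        ≡⟨ window (y + y) (≤-by _ (suc (q + q)) (arith₃ r q)) (≤-by _ 1 (arith₄ r q)) ⟩
    f (y + y + (suc q + suc q))      ≡⟨ cong f (trans (arith₅ r q) (cong (λ z → z + z) (sym m′≡))) ⟩
    f (m′ + m′)                      ≡⟨ sym last-pair ⟩
    f (suc (m′ + m′))                ≡⟨ cong f (cong (λ z → suc (z + z)) m′≡) ⟩
    f (suc ((r + P) + (r + P)))      ≡⟨ cong f (sym (cong suc (arith₅ r q))) ⟩
    f (suc (y + y) + (suc q + suc q)) ≡⟨ sym (window (suc (y + y)) (≤-trans (≤-by _ (suc (q + q)) (arith₃ r q)) (n≤1+n _)) (≤-by _ 0 (arith₇ r q))) ⟩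
    f (suc (y + y))                  ≡⟨ odd-pos y (subst (suc y <_) (sym m≡) (≤-by (suc (suc y)) q (arith₆ r q))) ⟩
    not (g y)                        ∎)
    where
    open ≡-Reasoning
    y = r + suc q
    P = suc q + suc q
    m′≡ : m′ ≡ r + P
    m′≡ = suc-injective (trans (sym m≡1+m′) m≡)
    window = periodic-between {f} periodic
    arith₁ : ∀ r q → r + suc q ≡ 1 + (r + q)
    arith₁ = solve-∀
    arith₂ : ∀ r q → suc (r + (suc q + suc q)) ≡ suc (r + suc q) + suc q
    arith₂ = solve-∀
    arith₃ : ∀ r q → (r + suc q) + (r + suc q) ≡ suc (r + r) + suc (q + q)
    arith₃ = solve-∀
    arith₄ : ∀ r q → suc (r + r) + (suc q + suc q) ≡ (r + suc q) + (r + suc q) + 1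
    arith₄ = solve-∀
    arith₅ : ∀ r q → (r + suc q) + (r + suc q) + (suc q + suc q) ≡ (r + (suc q + suc q)) + (r + (suc q + suc q))
    arith₅ = solve-∀
    arith₆ : ∀ r q → suc (r + (suc q + suc q)) ≡ suc (suc (r + suc q)) + q
    arith₆ = solve-∀
    arith₇ : ∀ r q → suc (r + r) + (suc q + suc q) ≡ suc ((r + suc q) + (r + suc q)) + 0
    arith₇ = solve-∀

  -- An overlap of odd period 2q+1 ≥ 7 ending at the last letter makes
  -- g r = g (r+1) = g (r+2), where 2r+1 is its start.
  right-end-odd-period : ∀ r n → let q = 3 + n in m ≡ suc (suc (r + (q + q))) →
    (∀ k → k ≤ suc (q + q) → f (suc (r + r) + k) ≡ f (suc (r + r) + k + suc (q + q))) → HasOverlap g m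
  right-end-odd-period r n m≡ periodic =
    cube-overlap {g} r (odd-shift-step q r (window _ ≤-refl (≤-trans a₁ (≤-trans a₂ (≤-trans a₃ top)))) (window _ a₁ (≤-trans a₂ (≤-trans a₃ top))) room₀)
                       (odd-shift-step q (suc r) (window _ (≤-trans a₁ a₂) (≤-trans a₃ top)) (window _ (≤-trans a₁ (≤-trans a₂ a₃)) top) room₁)
                       room₂
    where
    q = 3 + n
    window = periodic-between {f} periodic
    a₁ : suc (r + r) ≤ suc r + suc r
    a₁ = 2x+1≤2[x+1] r
    a₂ : suc r + suc r ≤ suc (suc r + suc r)
    a₂ = n≤1+n _
    a₃ : suc (suc r + suc r) ≤ suc (suc r) + suc (suc r)
    a₃ = 2x+1≤2[x+1] (suc r)
    top : suc (suc r) + suc (suc r) ≤ suc (r + r) + suc (q + q)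
    top = ≤-by _ (suc (suc (suc (suc (n + n))))) (arith₀ r n)
      where
      arith₀ : ∀ r n → suc (r + r) + suc ((3 + n) + (3 + n)) ≡ suc (suc r) + suc (suc r) + suc (suc (suc (suc (n + n))))
      arith₀ = solve-∀
    room₁ : suc (suc (suc r + q)) < m
    room₁ = subst (suc (suc (suc r + q)) <_) (sym m≡) (≤-by _ (suc n) (arith₁ r n))
      where
      arith₁ : ∀ r n → suc (suc (r + ((3 + n) + (3 + n)))) ≡ suc (suc (suc (suc r + (3 + n)))) + suc n
      arith₁ = solve-∀
    room₀ : suc (suc (r + q)) < m
    room₀ = ≤-trans (n≤1+n _) room₁
    room₂ : suc (suc r) < m
    room₂ = ≤-trans (s≤s (s≤s (s≤s (≤-trans (n≤1+n _) (m≤m+n (suc r) q))))) room₁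

  right-end : ∀ i p → suc (i + (p + p)) ≡ m + m → OverlapAt f (m + m) i p →
              OverlapNearEnd f (m + m) ⊎ HasOverlap g m
  right-end i p reaches o@(p≥1 , _ , periodic) with parity i | parity p
  ... | _ , _           | zero , inj₁ refl = ⊥-elim (<⇒≱ p≥1 z≤n)
  ... | r , inj₁ refl   | suc q , inj₁ refl = ⊥-elim (double≢odd m (r + (suc q + suc q)) (trans (sym reaches) (cong suc (arith r q))))
    where
    arith : ∀ r q → r + r + ((suc q + suc q) + (suc q + suc q)) ≡ (r + (suc q + suc q)) + (r + (suc q + suc q))
    arith = solve-∀
  ... | r , inj₂ refl   | suc q , inj₁ refl = ⊥-elim (right-end-even-period r q (sym (halve-≡ (trans (sym (arith r q)) reaches))) periodic)
    where
    arith : ∀ r q → suc (suc (r + r) + ((suc q + suc q) + (suc q + suc q))) ≡ suc (r + (suc q + suc q)) + suc (r + (suc q + suc q))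
    arith = solve-∀
  ... | _ , _           | 0 , inj₂ refl = inj₁ (i , 1 , o , subst (_≤ i + 11) reaches (near-start i 2 (≤ᵇ⇒≤ 3 11 _)))
  ... | _ , _           | 1 , inj₂ refl = inj₁ (i , 3 , o , subst (_≤ i + 11) reaches (near-start i 6 (≤ᵇ⇒≤ 7 11 _)))
  ... | _ , _           | 2 , inj₂ refl = inj₁ (i , 5 , o , subst (_≤ i + 11) reaches (near-start i 10 (≤ᵇ⇒≤ 11 11 _)))
  ... | r , inj₁ refl   | suc (suc (suc n)) , inj₂ refl = ⊥-elim (double≢odd m (suc (r + (q + q))) (trans (sym reaches) (cong suc (arith r q))))
    where
    q = 3 + n
    arith : ∀ r q → r + r + (suc (q + q) + suc (q + q)) ≡ suc (r + (q + q)) + suc (r + (q + q))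
    arith = solve-∀
  ... | r , inj₂ refl   | suc (suc (suc n)) , inj₂ refl = inj₂ (right-end-odd-period r n (sym (halve-≡ (trans (sym (arith r q)) reaches))) periodic)
    where
    q = 3 + n
    arith : ∀ r q → suc (suc (r + r) + (suc (q + q) + suc (q + q))) ≡ suc (suc (r + (q + q))) + suc (suc (r + (q + q)))
    arith = solve-∀

  overlap-trichotomy : HasOverlap f (m + m) → HasOverlap f 11 ⊎ OverlapNearEnd f (m + m) ⊎ HasOverlap g m
  overlap-trichotomy (zero , p , o) = map₂ inj₂ (left-end p o)
  overlap-trichotomy (suc i , p , o@(p≥1 , fits , periodic)) with suc (suc i + (p + p)) <? m + m
  ... | yes inside  = inj₂ (inj₂ (interiorOverlap (suc i) p (s≤s z≤n) p≥1 inside periodic))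
  ... | no  ¬inside = inj₂ (right-end (suc i) p (≤-antisym fits (≮⇒≥ ¬inside)) o)

twist-noOverlap : ∀ V → 2 ≤ length V → NoOverlap V → ¬ HasOverlap (at (twist V)) 11 →
                  ¬ OverlapNearEnd (at (twist V)) (length V + length V) → NoOverlap (twist V)
twist-noOverlap (a ∷ V′) (s≤s 1≤m′) none no-start no-end ov =
  [ no-start , [ no-end , none ]′ ]′ (overlap-trichotomy (subst (HasOverlap (at (twist V))) (length-twist V) ov))
  where
  V = a ∷ V′
  open TwistFacts V
  open BoundaryOverlaps (at (twist V)) (at V) (length V) even-pos odd-pos
         (twist-first-pair V (s≤s 1≤m′)) (length V′) refl (last-pair (length V′) refl 1≤m′)

data Pre : Set where
  pA pB pC pD pE pF : Pre

data Suf : Set where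
  sA sB sC sD sE sF : Suf

pre : Pre → Word
pre pA = 𝟎 ∷ 𝟎 ∷ 𝟏 ∷ 𝟎 ∷ 𝟎 ∷ 𝟏 ∷ 𝟏 ∷ 𝟎 ∷ []
pre pB = 𝟏 ∷ 𝟏 ∷ 𝟎 ∷ 𝟏 ∷ 𝟏 ∷ 𝟎 ∷ 𝟎 ∷ 𝟏 ∷ []
pre pC = 𝟎 ∷ 𝟎 ∷ 𝟏 ∷ 𝟎 ∷ 𝟏 ∷ 𝟏 ∷ 𝟎 ∷ 𝟎 ∷ []
pre pD = 𝟎 ∷ 𝟎 ∷ 𝟏 ∷ 𝟎 ∷ 𝟏 ∷ 𝟏 ∷ 𝟎 ∷ 𝟏 ∷ []
pre pE = 𝟏 ∷ 𝟏 ∷ 𝟎 ∷ 𝟏 ∷ 𝟎 ∷ 𝟎 ∷ 𝟏 ∷ 𝟎 ∷ []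
pre pF = 𝟏 ∷ 𝟏 ∷ 𝟎 ∷ 𝟏 ∷ 𝟎 ∷ 𝟎 ∷ 𝟏 ∷ 𝟏 ∷ []

suf : Suf → Word
suf sA = 𝟎 ∷ 𝟏 ∷ 𝟏 ∷ 𝟎 ∷ 𝟎 ∷ 𝟏 ∷ 𝟎 ∷ 𝟎 ∷ []
suf sB = 𝟏 ∷ 𝟎 ∷ 𝟎 ∷ 𝟏 ∷ 𝟏 ∷ 𝟎 ∷ 𝟏 ∷ 𝟏 ∷ []
suf sC = 𝟎 ∷ 𝟎 ∷ 𝟏 ∷ 𝟏 ∷ 𝟎 ∷ 𝟏 ∷ 𝟎 ∷ 𝟎 ∷ []
suf sD = 𝟎 ∷ 𝟏 ∷ 𝟎 ∷ 𝟎 ∷ 𝟏 ∷ 𝟎 ∷ 𝟏 ∷ 𝟏 ∷ []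
suf sE = 𝟏 ∷ 𝟎 ∷ 𝟏 ∷ 𝟏 ∷ 𝟎 ∷ 𝟏 ∷ 𝟎 ∷ 𝟎 ∷ []
suf sF = 𝟏 ∷ 𝟏 ∷ 𝟎 ∷ 𝟎 ∷ 𝟏 ∷ 𝟎 ∷ 𝟏 ∷ 𝟏 ∷ []

length-pre : ∀ p → length (pre p) ≡ 8
length-pre pA = refl
length-pre pB = refl
length-pre pC = refl
length-pre pD = refl
length-pre pE = refl
length-pre pF = refl

length-suf : ∀ s → length (suf s) ≡ 8
length-suf sA = refl
length-suf sB = refl
length-suf sC = refl
length-suf sD = refl
length-suf sE = refl
length-suf sF = refl

-- The first 16 letters of twist V when V starts with pre p, and the last 16 letters
-- of twist V when V ends with suf s.
twistPre : Pre → Word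
twistPre p = flipHead (μ (pre p))

twistSuf : Suf → Word
twistSuf s = flipLast (μ (suf s))

length-twistPre : ∀ p → length (twistPre p) ≡ 16
length-twistPre p = trans (length-flipHead (μ (pre p))) (trans (length-μ (pre p)) (cong₂ _+_ (length-pre p) (length-pre p)))

length-twistSuf : ∀ s → length (twistSuf s) ≡ 16
length-twistSuf s = trans (length-flipLast (μ (suf s))) (trans (length-μ (suf s)) (cong₂ _+_ (length-suf s) (length-suf s)))

twistPre-start : ∀ p → ¬ HasOverlap (at (twistPre p)) 11
twistPre-start pA = refute (at (twistPre pA)) 11
twistPre-start pB = refute (at (twistPre pB)) 11
twistPre-start pC = refute (at (twistPre pC)) 11
twistPre-start pD = refute (at (twistPre pD)) 11
twistPre-start pE = refute (at (twistPre pE)) 11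
twistPre-start pF = refute (at (twistPre pF)) 11

twistSuf-noOverlap : ∀ s → ¬ HasOverlap (at (twistSuf s)) 16
twistSuf-noOverlap sA = refute (at (twistSuf sA)) 16
twistSuf-noOverlap sB = refute (at (twistSuf sB)) 16
twistSuf-noOverlap sC = refute (at (twistSuf sC)) 16
twistSuf-noOverlap sD = refute (at (twistSuf sD)) 16
twistSuf-noOverlap sE = refute (at (twistSuf sE)) 16
twistSuf-noOverlap sF = refute (at (twistSuf sF)) 16

nonEmpty-pre : ∀ p → NonEmpty (pre p)
nonEmpty-pre p = nonEmpty-length (pre p) (subst (1 ≤_) (sym (length-pre p)) (s≤s z≤n))

nonEmpty-suf : ∀ s → NonEmpty (suf s)
nonEmpty-suf s = nonEmpty-length (suf s) (subst (1 ≤_) (sym (length-suf s)) (s≤s z≤n))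

-- A word framed by an admissible prefix and an admissible suffix (which may overlap).
record Framed (V : Word) : Set where
  field
    first      : Pre
    last       : Suf
    afterPre   : Word
    beforeSuf  : Word
    starts     : V ≡ pre first ++ afterPre
    ends       : V ≡ beforeSuf ++ suf last
    afterPre≠[]  : NonEmpty afterPre
    beforeSuf≠[] : NonEmpty beforeSuf

module FramedTwist {V : Word} (F : Framed V) where
  open Framed F

  twist-starts : twist V ≡ twistPre first ++ flipLast (μ afterPre)
  twist-starts = trans (cong twist starts) (twist-++ (pre first) [] afterPre (nonEmpty-pre first) afterPre≠[])

  twist-ends : twist V ≡ flipHead (μ beforeSuf) ++ twistSuf last
  twist-ends = trans (cong twist ends) (twist-++ beforeSuf [] (suf last) beforeSuf≠[] (nonEmpty-suf last))

  length-twist-ends : length V + length V ≡ length (flipHead (μ beforeSuf)) + 16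
  length-twist-ends = trans (sym (length-twist V))
    (trans (cong length twist-ends) (trans (length-++ (flipHead (μ beforeSuf))) (cong (length (flipHead (μ beforeSuf)) +_) (length-twistSuf last))))

  noOverlap-twist : NoOverlap V → NoOverlap (twist V)
  noOverlap-twist none = twist-noOverlap V two none no-start no-end
    where
    two : 2 ≤ length V
    two = subst (2 ≤_) (sym (trans (cong length starts) (trans (length-++ (pre first)) (cong (_+ length afterPre) (length-pre first)))))
                (≤-trans (s≤s (s≤s z≤n)) (m≤m+n 8 (length afterPre)))
    no-start : ¬ HasOverlap (at (twist V)) 11
    no-start ov = twistPre-start first (shiftOverlap {h = at (twistPre first)} 0 embed ≤-refl ov)
      where
      embed : ∀ n → n < 11 → at (twist V) n ≡ at (twistPre first) n
      embed n n<11 = trans (cong (λ w → at w n) twist-starts)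
        (at-++ˡ (twistPre first) _ n (≤-trans n<11 (subst (11 ≤_) (sym (length-twistPre first)) (≤ᵇ⇒≤ 11 16 _))))
    no-end : ¬ OverlapNearEnd (at (twist V)) (length V + length V)
    no-end (i , p , o , near) = twistSuf-noOverlap last (i ∸ d , p , unshiftOverlap {h = at (twist V)} d (i ∸ d) p embed (subst₂ (λ L j → OverlapAt (at (twist V)) L j p) length-twist-ends (sym (m+[n∸m]≡n d≤i)) o))
      where
      d = length (flipHead (μ beforeSuf))
      d≤i : d ≤ i
      d≤i = +-cancelʳ-≤ 11 d i (≤-trans (+-monoʳ-≤ d (≤ᵇ⇒≤ 11 16 _)) (subst (_≤ i + 11) length-twist-ends near))
      embed : ∀ n → n < 16 → at (twistSuf last) n ≡ at (twist V) (d + n)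
      embed n _ = sym (trans (cong (λ w → at w (d + n)) twist-ends) (at-++ʳ (flipHead (μ beforeSuf)) (twistSuf last) n))

-- Cutting 5 letters off the front of
-- twistPre p leaves an admissible prefix when p is of class I, cutting 7 letters does so
-- when p is of class II; at the back, cutting 5 resp. 7 letters off twistSuf s works for
-- s of class I resp. II.
data PreI : Pre → Set where
  pA-I : PreI pA
  pB-I : PreI pB

data PreII : Pre → Set where
  pC-II : PreII pC
  pD-II : PreII pD
  pE-II : PreII pE
  pF-II : PreII pF

data SufI : Suf → Set where
  sA-I : SufI sA
  sB-I : SufI sB

data SufII : Suf → Set where
  sC-II : SufII sC
  sD-II : SufII sD
  sE-II : SufII sE
  sF-II : SufII sF

-- The admissible prefix starting at offset 0, 5 or 7 of twistPre p.
pre₀ : Pre → Pre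
pre₀ pA = pB
pre₀ pB = pA
pre₀ pC = pB
pre₀ pD = pB
pre₀ pE = pA
pre₀ pF = pA

pre₅ : ∀ p → PreI p → Pre
pre₅ pA pA-I = pD
pre₅ pB pB-I = pE

pre₇ : ∀ p → PreII p → Pre
pre₇ pC pC-II = pE
pre₇ pD pD-II = pF
pre₇ pE pE-II = pC
pre₇ pF pF-II = pD

-- The admissible suffix starting at offset 8, 3 or 1 of twistSuf s
-- (so that 0, 5 or 7 letters of twistSuf s follow it).
suf₈ : Suf → Suf
suf₈ sA = sA
suf₈ sB = sB
suf₈ sC = sA
suf₈ sD = sB
suf₈ sE = sA
suf₈ sF = sB

suf₃ : ∀ s → SufI s → Suf
suf₃ sA sA-I = sD
suf₃ sB sB-I = sE

suf₁ : ∀ s → SufII s → Suf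
suf₁ sC sC-II = sE
suf₁ sD sD-II = sF
suf₁ sE sE-II = sC
suf₁ sF sF-II = sD

Occurs : ℕ → Word → Word → Set
Occurs a o w = take 8 (drop a w) ≡ o

pre₀-occurs : ∀ p → Occurs 0 (pre (pre₀ p)) (twistPre p)
pre₀-occurs pA = refl
pre₀-occurs pB = refl
pre₀-occurs pC = refl
pre₀-occurs pD = refl
pre₀-occurs pE = refl
pre₀-occurs pF = refl

pre₅-occurs : ∀ p c → Occurs 5 (pre (pre₅ p c)) (twistPre p)
pre₅-occurs pA pA-I = refl
pre₅-occurs pB pB-I = refl

pre₇-occurs : ∀ p c → Occurs 7 (pre (pre₇ p c)) (twistPre p)
pre₇-occurs pC pC-II = refl
pre₇-occurs pD pD-II = refl
pre₇-occurs pE pE-II = refl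
pre₇-occurs pF pF-II = refl

suf₈-occurs : ∀ s → Occurs 8 (suf (suf₈ s)) (twistSuf s)
suf₈-occurs sA = refl
suf₈-occurs sB = refl
suf₈-occurs sC = refl
suf₈-occurs sD = refl
suf₈-occurs sE = refl
suf₈-occurs sF = refl

suf₃-occurs : ∀ s c → Occurs 3 (suf (suf₃ s c)) (twistSuf s)
suf₃-occurs sA sA-I = refl
suf₃-occurs sB sB-I = refl

suf₁-occurs : ∀ s c → Occurs 1 (suf (suf₁ s c)) (twistSuf s)
suf₁-occurs sC sC-II = refl
suf₁-occurs sD sD-II = refl
suf₁-occurs sE sE-II = refl
suf₁-occurs sF sF-II = refl

pre₀-I : ∀ p → PreI (pre₀ p)
pre₀-I pA = pB-I
pre₀-I pB = pA-I
pre₀-I pC = pB-I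
pre₀-I pD = pB-I
pre₀-I pE = pA-I
pre₀-I pF = pA-I

pre₅-II : ∀ p c → PreII (pre₅ p c)
pre₅-II pA pA-I = pD-II
pre₅-II pB pB-I = pE-II

pre₇-II : ∀ p c → PreII (pre₇ p c)
pre₇-II pC pC-II = pE-II
pre₇-II pD pD-II = pF-II
pre₇-II pE pE-II = pC-II
pre₇-II pF pF-II = pD-II

suf₈-I : ∀ s → SufI (suf₈ s)
suf₈-I sA = sA-I
suf₈-I sB = sB-I
suf₈-I sC = sA-I
suf₈-I sD = sB-I
suf₈-I sE = sA-I
suf₈-I sF = sB-I

suf₃-II : ∀ s c → SufII (suf₃ s c)
suf₃-II sA sA-I = sD-II
suf₃-II sB sB-I = sE-II

suf₁-II : ∀ s c → SufII (suf₁ s c)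
suf₁-II sC sC-II = sE-II
suf₁-II sD sD-II = sF-II
suf₁-II sE sE-II = sC-II
suf₁-II sF sF-II = sD-II

occurrence-split : ∀ a {o w : Word} → Occurs a o w → w ≡ take a w ++ o ++ drop 8 (drop a w)
occurrence-split a {o} {w} occ = sym (begin
  take a w ++ o ++ drop 8 (drop a w)                        ≡⟨ cong (λ z → take a w ++ z ++ drop 8 (drop a w)) (sym occ) ⟩
  take a w ++ take 8 (drop a w) ++ drop 8 (drop a w)        ≡⟨ cong (take a w ++_) (take++drop≡id 8 (drop a w)) ⟩
  take a w ++ drop a w                                      ≡⟨ take++drop≡id a w ⟩
  w                                                         ∎)
  where open ≡-Reasoning

regroup : ∀ (X P A M B S Z : Word) → (X ++ P ++ A) ++ M ++ (B ++ S ++ Z) ≡ X ++ (P ++ (A ++ M ++ B) ++ S) ++ Z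
regroup (x ∷ X) P       A       M       B       S Z = cong (x ∷_) (regroup X P A M B S Z)
regroup []      (x ∷ P) A       M       B       S Z = cong (x ∷_) (regroup [] P A M B S Z)
regroup []      []      (x ∷ A) M       B       S Z = cong (x ∷_) (regroup [] [] A M B S Z)
regroup []      []      []      (x ∷ M) B       S Z = cong (x ∷_) (regroup [] [] [] M B S Z)
regroup []      []      []      []      (x ∷ B) S Z = cong (x ∷_) (regroup [] [] [] [] B S Z)
regroup []      []      []      []      []      S Z = refl

Balanced : Pre → Suf → Set
Balanced p s = (PreI p × SufII s) ⊎ (PreII p × SufI s)

record Seed (m : ℕ) : Set where
  field
    first     : Pre
    last      : Suf
    middle    : Word
    noOverlap : NoOverlap (pre first ++ middle ++ suf last)
    length≡   : length (pre first ++ middle ++ suf last) ≡ m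
    balanced  : ∀ t → m ≡ suc (t + t) → Balanced first last

seedWord : ∀ {m} → Seed m → Word
seedWord S = pre first ++ middle ++ suf last
  where open Seed S

seed-framed : ∀ {m} (S : Seed m) → Framed (seedWord S)
seed-framed S = record
  { first = first ; last = last ; afterPre = middle ++ suf last ; beforeSuf = pre first ++ middle
  ; starts = refl ; ends = sym (++-assoc (pre first) middle (suf last))
  ; afterPre≠[] = nonEmpty-++ʳ middle (suf last) (nonEmpty-suf last)
  ; beforeSuf≠[] = nonEmpty-++ˡ (pre first) middle (nonEmpty-pre first) }
  where open Seed S

-- Reframing the twisted image of a seed: if pre p′ occurs at offset a of twistPre first
-- and suf s′ at offset b of twistSuf last, then the factor of twist V running from the
-- first occurrence to the second one is again an overlap-free framed word.  It misses
-- a letters at the front and 8 − b letters at the back of twist V.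
reframe : ∀ {k m} (S : Seed k) {p′ s′} a b →
          Occurs a (pre p′) (twistPre (Seed.first S)) → Occurs b (suf s′) (twistSuf (Seed.last S)) →
          m + (a ⊓ 16 + (16 ∸ b ∸ 8)) ≡ k + k → (∀ t → m ≡ suc (t + t) → Balanced p′ s′) → Seed m
reframe {k} {m} S {p′} {s′} a b occ₁ occ₂ lengths bal = record
  { first = p′ ; last = s′ ; middle = A ++ μ middle ++ B
  ; noOverlap = noOverlap-infix X V′ Z (subst NoOverlap shape (noOverlap-twist noOverlap))
  ; length≡ = +-cancelʳ-≡ (a ⊓ 16 + (16 ∸ b ∸ 8)) _ _ (trans cut-lengths (sym lengths))
  ; balanced = bal }
  where
  open Seed S
  open FramedTwist (seed-framed S) using (noOverlap-twist)
  X = take a (twistPre first)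
  A = drop 8 (drop a (twistPre first))
  B = take b (twistSuf last)
  Z = drop 8 (drop b (twistSuf last))
  V′ = pre p′ ++ (A ++ μ middle ++ B) ++ suf s′
  shape : twist (seedWord S) ≡ X ++ V′ ++ Z
  shape = begin
    twist (pre first ++ middle ++ suf last)               ≡⟨ twist-++ (pre first) middle (suf last) (nonEmpty-pre first) (nonEmpty-suf last) ⟩
    twistPre first ++ μ middle ++ twistSuf last           ≡⟨ cong₂ (λ u v → u ++ μ middle ++ v) (occurrence-split a occ₁) (occurrence-split b occ₂) ⟩
    (X ++ pre p′ ++ A) ++ μ middle ++ (B ++ suf s′ ++ Z)  ≡⟨ regroup X (pre p′) A (μ middle) B (suf s′) Z ⟩
    X ++ V′ ++ Z                                          ∎
    where open ≡-Reasoning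
  length-X : length X ≡ a ⊓ 16
  length-X = trans (length-take a (twistPre first)) (cong (a ⊓_) (length-twistPre first))
  length-Z : length Z ≡ 16 ∸ b ∸ 8
  length-Z = trans (length-drop 8 (drop b (twistSuf last)))
               (cong (_∸ 8) (trans (length-drop b (twistSuf last)) (cong (_∸ b) (length-twistSuf last))))
  swap : ∀ v x z → v + (x + z) ≡ x + (v + z)
  swap = solve-∀
  cut-lengths : length V′ + (a ⊓ 16 + (16 ∸ b ∸ 8)) ≡ k + k
  cut-lengths = begin
    length V′ + (a ⊓ 16 + (16 ∸ b ∸ 8))       ≡⟨ swap (length V′) (a ⊓ 16) (16 ∸ b ∸ 8) ⟩
    a ⊓ 16 + (length V′ + (16 ∸ b ∸ 8))       ≡⟨ sym (cong₂ (λ x z → x + (length V′ + z)) length-X length-Z) ⟩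
    length X + (length V′ + length Z)         ≡⟨ sym (length-infix X V′ Z) ⟩
    length (X ++ V′ ++ Z)                     ≡⟨ cong length (sym shape) ⟩
    length (twist (seedWord S))               ≡⟨ length-twist (seedWord S) ⟩
    length (seedWord S) + length (seedWord S) ≡⟨ cong₂ _+_ length≡ length≡ ⟩
    k + k                                     ∎
    where open ≡-Reasoning

-- Doubling: twist V itself is framed by pre₀ first and suf₈ last.
double : ∀ {k} → Seed k → Seed (k + k)
double {k} S = reframe S 0 8 (pre₀-occurs (Seed.first S)) (suf₈-occurs (Seed.last S)) (+-identityʳ (k + k)) (λ t e → ⊥-elim (double≢odd k t e))

-- Trimming 5, resp. 7, letters off the twisted image of an odd-length seed, at the end
-- whose class allows it; the result is balanced whatever its length.
trim5 : ∀ {k m} (S : Seed k) → (∃ λ t → k ≡ suc (t + t)) → m + 5 ≡ k + k → Seed m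
trim5 S (t , odd) lengths with Seed.balanced S t odd
... | inj₁ (front , _) = reframe S 5 8 (pre₅-occurs _ front) (suf₈-occurs (Seed.last S)) lengths (λ _ _ → inj₂ (pre₅-II _ front , suf₈-I (Seed.last S)))
... | inj₂ (_ , back)  = reframe S 0 3 (pre₀-occurs (Seed.first S)) (suf₃-occurs _ back) lengths (λ _ _ → inj₁ (pre₀-I (Seed.first S) , suf₃-II _ back))

trim7 : ∀ {k m} (S : Seed k) → (∃ λ t → k ≡ suc (t + t)) → m + 7 ≡ k + k → Seed m
trim7 S (t , odd) lengths with Seed.balanced S t odd
... | inj₂ (front , _) = reframe S 7 8 (pre₇-occurs _ front) (suf₈-occurs (Seed.last S)) lengths (λ _ _ → inj₂ (pre₇-II _ front , suf₈-I (Seed.last S)))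
... | inj₁ (_ , back)  = reframe S 0 1 (pre₀-occurs (Seed.first S)) (suf₁-occurs _ back) lengths (λ _ _ → inj₁ (pre₀-I (Seed.first S) , suf₁-II _ back))

IfOdd : ℕ → Set → Set
IfOdd zero          A = ⊤
IfOdd (suc zero)    A = A
IfOdd (suc (suc m)) A = IfOdd m A

ifOdd : ∀ {A} m → IfOdd m A → ∀ t → m ≡ suc (t + t) → A
ifOdd (suc zero)    a zero    refl = a
ifOdd (suc (suc m)) a (suc t) e    = ifOdd m a t (trans (suc-injective (suc-injective e)) (+-suc t t))

seedOf : ∀ p r s → let w = pre p ++ r ++ suf s in IfOdd (length w) (Balanced p s) →
         {check : False (hasOverlap? (at w) (length w))} → Seed (length w)
seedOf p r s balanced {check} = record
  { first = p ; last = s ; middle = r ; noOverlap = refute (at w) (length w) {check}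
  ; length≡ = refl ; balanced = ifOdd (length w) balanced }
  where w = pre p ++ r ++ suf s

base : ∀ k → k ≤ 14 → Seed (17 + k)
base 0  _ = seedOf pA (𝟎 ∷ []) sE (inj₁ (pA-I , sE-II))
base 1  _ = seedOf pC (𝟏 ∷ 𝟏 ∷ []) sD tt
base 2  _ = seedOf pA (𝟏 ∷ 𝟎 ∷ 𝟎 ∷ []) sE (inj₁ (pA-I , sE-II))
base 3  _ = seedOf pA (𝟎 ∷ 𝟏 ∷ 𝟎 ∷ 𝟏 ∷ []) sB tt
base 4  _ = seedOf pA (𝟎 ∷ 𝟏 ∷ 𝟎 ∷ 𝟏 ∷ 𝟏 ∷ []) sC (inj₁ (pA-I , sC-II))
base 5  _ = seedOf pA (𝟎 ∷ 𝟏 ∷ 𝟎 ∷ 𝟏 ∷ 𝟏 ∷ 𝟎 ∷ []) sB tt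
base 6  _ = seedOf pA (𝟏 ∷ 𝟎 ∷ 𝟎 ∷ 𝟏 ∷ 𝟎 ∷ 𝟏 ∷ 𝟏 ∷ []) sC (inj₁ (pA-I , sC-II))
base 7  _ = seedOf pA (𝟎 ∷ 𝟏 ∷ 𝟎 ∷ 𝟏 ∷ 𝟏 ∷ 𝟎 ∷ 𝟏 ∷ 𝟎 ∷ []) sA tt
base 8  _ = seedOf pA (𝟎 ∷ 𝟏 ∷ 𝟎 ∷ 𝟏 ∷ 𝟏 ∷ 𝟎 ∷ 𝟎 ∷ 𝟏 ∷ 𝟏 ∷ []) sD (inj₁ (pA-I , sD-II))
base 9  _ = seedOf pA (𝟎 ∷ 𝟏 ∷ 𝟎 ∷ 𝟏 ∷ 𝟏 ∷ 𝟎 ∷ 𝟏 ∷ 𝟎 ∷ 𝟎 ∷ 𝟏 ∷ []) sA tt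
base 10 _ = seedOf pA (𝟏 ∷ 𝟎 ∷ 𝟎 ∷ 𝟏 ∷ 𝟎 ∷ 𝟏 ∷ 𝟏 ∷ 𝟎 ∷ 𝟏 ∷ 𝟎 ∷ 𝟎 ∷ []) sF (inj₁ (pA-I , sF-II))
base 11 _ = seedOf pA (𝟎 ∷ 𝟏 ∷ 𝟎 ∷ 𝟏 ∷ 𝟏 ∷ 𝟎 ∷ 𝟎 ∷ 𝟏 ∷ 𝟏 ∷ 𝟎 ∷ 𝟏 ∷ 𝟎 ∷ []) sA tt
base 12 _ = seedOf pA (𝟎 ∷ 𝟏 ∷ 𝟎 ∷ 𝟏 ∷ 𝟏 ∷ 𝟎 ∷ 𝟎 ∷ 𝟏 ∷ 𝟏 ∷ 𝟎 ∷ 𝟏 ∷ 𝟎 ∷ 𝟎 ∷ []) sE (inj₁ (pA-I , sE-II))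
base 13 _ = seedOf pA (𝟎 ∷ 𝟏 ∷ 𝟎 ∷ 𝟏 ∷ 𝟏 ∷ 𝟎 ∷ 𝟎 ∷ 𝟏 ∷ 𝟏 ∷ 𝟎 ∷ 𝟏 ∷ 𝟎 ∷ 𝟎 ∷ 𝟏 ∷ []) sA tt
base 14 _ = seedOf pA (𝟏 ∷ 𝟎 ∷ 𝟎 ∷ 𝟏 ∷ 𝟎 ∷ 𝟏 ∷ 𝟏 ∷ 𝟎 ∷ 𝟎 ∷ 𝟏 ∷ 𝟏 ∷ 𝟎 ∷ 𝟏 ∷ 𝟎 ∷ 𝟎 ∷ []) sF (inj₁ (pA-I , sF-II))
base (suc (suc (suc (suc (suc (suc (suc (suc (suc (suc (suc (suc (suc (suc (suc k))))))))))))))) (s≤s (s≤s (s≤s (s≤s (s≤s (s≤s (s≤s (s≤s (s≤s (s≤s (s≤s (s≤s (s≤s (s≤s ()))))))))))))))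

pow2-double : ∀ k → IsPowerOfTwo k → IsPowerOfTwo (k + k)
pow2-double k (j , refl) = suc j , cong (2 ^ j +_) (sym (+-identityʳ (2 ^ j)))

odd-not-pow2 : ∀ t → ¬ IsPowerOfTwo (suc (suc t + suc t))
odd-not-pow2 t (zero  , ())
odd-not-pow2 t (suc j , e) = double≢odd (2 ^ j) (suc t) (sym (trans e (cong (2 ^ j +_) (+-identityʳ (2 ^ j)))))

-- An even length 2k ≥ 32 (not 32 itself) comes
-- from k ≥ 17 by doubling; a length 4h+1 ≥ 32 from 2h+3 by trimming 5 letters; a length
-- 4h+3 ≥ 32 from 2h+5 by trimming 7 letters.
even-reduction : ∀ k → 32 ≤ k + k → ¬ IsPowerOfTwo (k + k) → k < k + k × 17 ≤ k
even-reduction k 32≤2k np with m≤n⇒m<n∨m≡n (halve-≤ {16} {k} 32≤2k)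
... | inj₂ refl = ⊥-elim (np (5 , refl))
... | inj₁ 17≤k = subst (_< k + k) (+-identityʳ k) (+-monoʳ-< k (≤-trans (s≤s z≤n) 17≤k)) , 17≤k

quarter : ∀ h → 28 ≤ (h + h) + (h + h) → 7 ≤ h
quarter h 28≤4h = halve-≤ {7} {h} (halve-≤ {14} {h + h} 28≤4h)

reduction-4h+1 : ∀ h → 32 ≤ suc ((h + h) + (h + h)) →
                 suc (suc h + suc h) < suc ((h + h) + (h + h)) × 17 ≤ suc (suc h + suc h)
reduction-4h+1 h 32≤m with m≤n⇒∃[o]m+o≡n (quarter h (≤-trans (≤ᵇ⇒≤ 28 31 _) (≤-pred 32≤m)))
... | d , refl = ≤-by _ (11 + (d + d)) (arith₁ d) , ≤-by 17 (d + d) (arith₂ d)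
  where
  arith₁ : ∀ d → suc (((7 + d) + (7 + d)) + ((7 + d) + (7 + d))) ≡ suc (suc (suc (7 + d) + suc (7 + d))) + (11 + (d + d))
  arith₁ = solve-∀
  arith₂ : ∀ d → suc (suc (7 + d) + suc (7 + d)) ≡ 17 + (d + d)
  arith₂ = solve-∀

reduction-4h+3 : ∀ h → 32 ≤ suc (suc (h + h) + suc (h + h)) →
                 suc (suc (suc h) + suc (suc h)) < suc (suc (h + h) + suc (h + h)) × 17 ≤ suc (suc (suc h) + suc (suc h))
reduction-4h+3 h 32≤m with m≤n⇒∃[o]m+o≡n (quarter h (≤-trans (≤ᵇ⇒≤ 28 29 _) (≤-pred (≤-pred (≤-pred (subst (32 ≤_) (arith₀ h) 32≤m))))))
  where
  arith₀ : ∀ h → suc (suc (h + h) + suc (h + h)) ≡ 3 + ((h + h) + (h + h))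
  arith₀ = solve-∀
... | d , refl = ≤-by _ (11 + (d + d)) (arith₁ d) , ≤-by 17 (2 + (d + d)) (arith₂ d)
  where
  arith₁ : ∀ d → suc (suc (7 + d + (7 + d)) + suc (7 + d + (7 + d))) ≡ suc (suc (suc (suc (7 + d)) + suc (suc (7 + d)))) + (11 + (d + d))
  arith₁ = solve-∀
  arith₂ : ∀ d → suc (suc (suc (7 + d)) + suc (suc (7 + d))) ≡ 17 + (2 + (d + d))
  arith₂ = solve-∀

seed : ∀ m → 17 ≤ m → ¬ IsPowerOfTwo m → Seed m
seed = <-rec (λ m → 17 ≤ m → ¬ IsPowerOfTwo m → Seed m) step
  where
  step : ∀ m → (∀ {k} → k < m → 17 ≤ k → ¬ IsPowerOfTwo k → Seed k) → 17 ≤ m → ¬ IsPowerOfTwo m → Seed m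
  step m rec 17≤m np with m ≤? 31
  ... | yes m≤31 = subst Seed (m+[n∸m]≡n 17≤m) (base (m ∸ 17) (∸-monoˡ-≤ 17 m≤31))
  ... | no  m≰31 with parity m | ≰⇒> m≰31
  ...   | k , inj₁ refl | 32≤m with even-reduction k 32≤m np
  ...     | k<m , 17≤k = double (rec k<m 17≤k (np ∘ pow2-double k))
  step m rec 17≤m np | no _ | k , inj₂ refl | 32≤m with parity k
  ...   | h , inj₁ refl with reduction-4h+1 h 32≤m
  ...     | k′<m , 17≤k′ = trim5 (rec k′<m 17≤k′ (odd-not-pow2 h)) (suc h , refl) (arith h)
    where
    arith : ∀ h → suc ((h + h) + (h + h)) + 5 ≡ suc (suc h + suc h) + suc (suc h + suc h)
    arith = solve-∀
  step m rec 17≤m np | no _ | k , inj₂ refl | 32≤m | h , inj₂ refl with reduction-4h+3 h 32≤m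
  ...     | k′<m , 17≤k′ = trim7 (rec k′<m 17≤k′ (odd-not-pow2 (suc h))) (suc (suc h) , refl) (arith h)
    where
    arith : ∀ h → suc (suc (h + h) + suc (h + h)) + 7 ≡ suc (suc (suc h) + suc (suc h)) + suc (suc (suc h) + suc (suc h))
    arith = solve-∀

FramedWord : ℕ → Set
FramedWord m = Σ Word λ U → length U ≡ m × Framed U × NoOverlap U

framedOf : ∀ p r₁ r₂ s → pre p ++ r₁ ≡ r₂ ++ suf s → {ne₁ : NonEmpty r₁} {ne₂ : NonEmpty r₂} →
           let w = pre p ++ r₁ in {check : False (hasOverlap? (at w) (length w))} → FramedWord (length w)
framedOf p r₁ r₂ s agree {ne₁} {ne₂} {check} =
  pre p ++ r₁ , refl ,
  record { first = p ; last = s ; afterPre = r₁ ; beforeSuf = r₂ ; starts = refl ; ends = agree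
         ; afterPre≠[] = ne₁ ; beforeSuf≠[] = ne₂ } ,
  refute (at (pre p ++ r₁)) (length (pre p ++ r₁)) {check}

-- Framed words of the lengths 10 … 15, where prefix and suffix overlap.
small : ∀ k → k ≤ 5 → FramedWord (10 + k)
small 0 _ = framedOf pA (𝟏 ∷ 𝟏 ∷ []) (𝟎 ∷ 𝟎 ∷ []) sB refl
small 1 _ = framedOf pA (𝟏 ∷ 𝟎 ∷ 𝟎 ∷ []) (𝟎 ∷ 𝟎 ∷ 𝟏 ∷ []) sC refl
small 2 _ = framedOf pA (𝟎 ∷ 𝟏 ∷ 𝟎 ∷ 𝟎 ∷ []) (𝟎 ∷ 𝟎 ∷ 𝟏 ∷ 𝟎 ∷ []) sA refl
small 3 _ = framedOf pA (𝟎 ∷ 𝟏 ∷ 𝟎 ∷ 𝟏 ∷ 𝟏 ∷ []) (𝟎 ∷ 𝟎 ∷ 𝟏 ∷ 𝟎 ∷ 𝟎 ∷ []) sF refl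
small 4 _ = framedOf pC (𝟏 ∷ 𝟏 ∷ 𝟎 ∷ 𝟏 ∷ 𝟎 ∷ 𝟎 ∷ []) (𝟎 ∷ 𝟎 ∷ 𝟏 ∷ 𝟎 ∷ 𝟏 ∷ 𝟏 ∷ []) sC refl
small 5 _ = framedOf pA (𝟏 ∷ 𝟎 ∷ 𝟎 ∷ 𝟏 ∷ 𝟎 ∷ 𝟏 ∷ 𝟏 ∷ []) (𝟎 ∷ 𝟎 ∷ 𝟏 ∷ 𝟎 ∷ 𝟎 ∷ 𝟏 ∷ 𝟏 ∷ []) sD refl
small (suc (suc (suc (suc (suc (suc k)))))) (s≤s (s≤s (s≤s (s≤s (s≤s ())))))

framed-word : ∀ m → 10 ≤ m → ¬ IsPowerOfTwo m → FramedWord m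
framed-word m 10≤m np with 17 ≤? m
... | yes 17≤m = seedWord S , Seed.length≡ S , seed-framed S , Seed.noOverlap S
  where S = seed m 17≤m np
... | no  m≱17 with m≤n⇒m<n∨m≡n (≤-pred (≰⇒> m≱17))
...   | inj₂ refl = ⊥-elim (np (4 , refl))
...   | inj₁ m<16 = subst FramedWord (m+[n∸m]≡n 10≤m) (small (m ∸ 10) (∸-monoˡ-≤ 10 (≤-pred m<16)))

insert : ℕ → Bool → Word → Word
insert zero    a w       = a ∷ w
insert (suc t) a []      = a ∷ []
insert (suc t) a (x ∷ w) = x ∷ insert t a w

insert-split : ∀ w′ w″ a → insert (length w′) a (w′ ++ w″) ≡ w′ ++ a ∷ w″
insert-split []       w″ a = refl
insert-split (x ∷ w′) w″ a = cong (x ∷_) (insert-split w′ w″ a)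

insert-++ˡ : ∀ t a X Y → t ≤ length X → insert t a (X ++ Y) ≡ insert t a X ++ Y
insert-++ˡ zero    a X       Y _         = refl
insert-++ˡ (suc t) a (x ∷ X) Y (s≤s t≤X) = cong (x ∷_) (insert-++ˡ t a X Y t≤X)

insert-++ʳ : ∀ X t a Y → insert (length X + t) a (X ++ Y) ≡ X ++ insert t a Y
insert-++ʳ []      t a Y = refl
insert-++ʳ (x ∷ X) t a Y = cong (x ∷_) (insert-++ʳ X t a Y)

containsOverlap-infix : ∀ X W Y → ContainsOverlap W → ContainsOverlap (X ++ W ++ Y)
containsOverlap-infix X W Y (o , ov , u , v , refl) = o , ov , X ++ u , v ++ Y , reassociate
  where
  reassociate : X ++ (u ++ o ++ v) ++ Y ≡ (X ++ u) ++ o ++ v ++ Y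
  reassociate = trans (cong (X ++_) (trans (++-assoc u (o ++ v) Y) (cong (u ++_) (++-assoc o v Y)))) (sym (++-assoc X u (o ++ v ++ Y)))

insertions : (w : Word) (s n : ℕ) → Maybe (∀ d → d ≤ n → ∀ a → ContainsOverlap (insert (s + d) a w))
insertions w s = everyUpTo (λ d → everyLetter (λ a → findOverlap (insert (s + d) a w)))

front-insertions : ∀ p t → t ≤ 7 → ∀ a → ContainsOverlap (insert t a (twistPre p))
front-insertions pA = from-just (insertions (twistPre pA) 0 7)
front-insertions pB = from-just (insertions (twistPre pB) 0 7)
front-insertions pC = from-just (insertions (twistPre pC) 0 7)
front-insertions pD = from-just (insertions (twistPre pD) 0 7)
front-insertions pE = from-just (insertions (twistPre pE) 0 7)
front-insertions pF = from-just (insertions (twistPre pF) 0 7)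

back-insertions : ∀ s d → d ≤ 6 → ∀ a → ContainsOverlap (insert (10 + d) a (twistSuf s))
back-insertions sA = from-just (insertions (twistSuf sA) 10 6)
back-insertions sB = from-just (insertions (twistSuf sB) 10 6)
back-insertions sC = from-just (insertions (twistSuf sC) 10 6)
back-insertions sD = from-just (insertions (twistSuf sD) 10 6)
back-insertions sE = from-just (insertions (twistSuf sE) 10 6)
back-insertions sF = from-just (insertions (twistSuf sF) 10 6)

block-insertions : ∀ g → length g ≡ 5 → ContainsOverlap g ⊎
                   (∀ a → ContainsOverlap (insert 5 a (μ g)) × ContainsOverlap (insert 6 a (μ g)))
block-insertions = from-just (everyWord (λ g → mapᴹ inj₁ (findOverlap g) <∣> mapᴹ inj₂ (everyLetter (λ a →
                     zip (findOverlap (insert 5 a (μ g))) (findOverlap (insert 6 a (μ g)))))) 5)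

block-split : ∀ j (U : Word) → j + 5 < length U →
  Σ Word λ U₁ → Σ Word λ g → Σ Word λ U₂ → (U ≡ U₁ ++ g ++ U₂) × (length U₁ ≡ j) × (length g ≡ 5) × NonEmpty U₂
block-split zero    (b₀ ∷ b₁ ∷ b₂ ∷ b₃ ∷ b₄ ∷ b₅ ∷ U) _ = [] , (b₀ ∷ b₁ ∷ b₂ ∷ b₃ ∷ b₄ ∷ []) , (b₅ ∷ U) , refl , refl , refl , tt
block-split zero    []                          ()
block-split zero    (_ ∷ [])                    (s≤s ())
block-split zero    (_ ∷ _ ∷ [])                (s≤s (s≤s ()))
block-split zero    (_ ∷ _ ∷ _ ∷ [])            (s≤s (s≤s (s≤s ())))
block-split zero    (_ ∷ _ ∷ _ ∷ _ ∷ [])        (s≤s (s≤s (s≤s (s≤s ()))))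
block-split zero    (_ ∷ _ ∷ _ ∷ _ ∷ _ ∷ [])    (s≤s (s≤s (s≤s (s≤s (s≤s ())))))
block-split (suc j) (x ∷ U) (s≤s fits) with block-split j U fits
... | U₁ , g , U₂ , split , length-U₁ , length-g , ne = x ∷ U₁ , g , U₂ , cong (x ∷_) split , cong suc length-U₁ , length-g , ne

-- Inserting a letter at position 2j + 5 or 2j + 6 of twist U, with 1 ≤ j and j + 5 < |U|,
-- lands in the middle of the image μ g of an overlap-free 5-letter factor g of U.
middle-insertion : ∀ U → NoOverlap U → ∀ j t₀ a → 1 ≤ j → j + 5 < length U → (t₀ ≡ 5) ⊎ (t₀ ≡ 6) →
                   ContainsOverlap (insert ((j + j) + t₀) a (twist U))
middle-insertion U none j t₀ a j≥1 fits t₀∈ with block-split j U fits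
... | U₁ , g , U₂ , split , length-U₁ , length-g , ne₂ =
  subst ContainsOverlap (sym inserted) (containsOverlap-infix X (insert t₀ a (μ g)) Y in-block)
  where
  X = flipHead (μ U₁)
  Y = flipLast (μ U₂)
  ne₁ : NonEmpty U₁
  ne₁ = nonEmpty-length U₁ (subst (1 ≤_) (sym length-U₁) j≥1)
  length-X : length X ≡ j + j
  length-X = trans (length-flipHead (μ U₁)) (trans (length-μ U₁) (cong₂ _+_ length-U₁ length-U₁))
  t₀≤10 : t₀ ≤ length (μ g)
  t₀≤10 = subst (t₀ ≤_) (sym (trans (length-μ g) (cong₂ _+_ length-g length-g))) (t₀≤ t₀∈)
    where
    t₀≤ : (t₀ ≡ 5) ⊎ (t₀ ≡ 6) → t₀ ≤ 10
    t₀≤ (inj₁ refl) = ≤ᵇ⇒≤ 5 10 _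
    t₀≤ (inj₂ refl) = ≤ᵇ⇒≤ 6 10 _
  inserted : insert ((j + j) + t₀) a (twist U) ≡ X ++ insert t₀ a (μ g) ++ Y
  inserted = begin
    insert ((j + j) + t₀) a (twist U)             ≡⟨ cong₂ (λ n w → insert (n + t₀) a w) (sym length-X) (trans (cong twist split) (twist-++ U₁ g U₂ ne₁ ne₂)) ⟩
    insert (length X + t₀) a (X ++ μ g ++ Y)      ≡⟨ insert-++ʳ X t₀ a (μ g ++ Y) ⟩
    X ++ insert t₀ a (μ g ++ Y)                   ≡⟨ cong (X ++_) (insert-++ˡ t₀ a (μ g) Y t₀≤10) ⟩
    X ++ insert t₀ a (μ g) ++ Y                   ∎
    where open ≡-Reasoning
  g-overlap-free : ¬ ContainsOverlap g
  g-overlap-free c = none (containsOverlap⇒hasOverlap U (subst ContainsOverlap (sym split) (containsOverlap-infix U₁ g U₂ c)))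
  in-block : ContainsOverlap (insert t₀ a (μ g))
  in-block = pick t₀∈ (block-insertions g length-g)
    where
    pick : ∀ {t} → (t ≡ 5) ⊎ (t ≡ 6) →
           ContainsOverlap g ⊎ (∀ b → ContainsOverlap (insert 5 b (μ g)) × ContainsOverlap (insert 6 b (μ g))) →
           ContainsOverlap (insert t a (μ g))
    pick _           (inj₁ c)     = ⊥-elim (g-overlap-free c)
    pick (inj₁ refl) (inj₂ cases) = proj₁ (cases a)
    pick (inj₂ refl) (inj₂ cases) = proj₂ (cases a)

interior-position : ∀ t m → 8 ≤ t → t + 7 ≤ m + m →
  Σ ℕ λ j → Σ ℕ λ t₀ → (t ≡ (j + j) + t₀) × (1 ≤ j) × (j + 5 < m) × ((t₀ ≡ 5) ⊎ (t₀ ≡ 6))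
interior-position t m 8≤t fits with parity t
... | q , inj₁ refl with m≤n⇒∃[o]m+o≡n (halve-≤ {4} {q} 8≤t)
...   | d , refl = suc d , 6 , arith₁ d , s≤s z≤n , ≤-trans (≤-reflexive (arith₂ d)) (<⇒≤ (halve-< (subst (_≤ m + m) (arith₃ d) fits))) , inj₂ refl
  where
  arith₁ : ∀ d → (4 + d) + (4 + d) ≡ (suc d + suc d) + 6
  arith₁ = solve-∀
  arith₂ : ∀ d → suc (suc d + 5) ≡ 7 + d
  arith₂ = solve-∀
  arith₃ : ∀ d → (4 + d) + (4 + d) + 7 ≡ suc ((7 + d) + (7 + d))
  arith₃ = solve-∀
interior-position t m 8≤t fits | q , inj₂ refl with m≤n⇒∃[o]m+o≡n (halve-< {3} {q} (≤-pred 8≤t))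
...   | d , refl = suc (suc d) , 5 , arith₁ d , s≤s z≤n , ≤-trans (≤-reflexive (arith₂ d)) (halve-≤ (subst (_≤ m + m) (arith₃ d) fits)) , inj₁ refl
  where
  arith₁ : ∀ d → suc ((4 + d) + (4 + d)) ≡ (suc (suc d) + suc (suc d)) + 5
  arith₁ = solve-∀
  arith₂ : ∀ d → suc (suc (suc d) + 5) ≡ 8 + d
  arith₂ = solve-∀
  arith₃ : ∀ d → suc ((4 + d) + (4 + d)) + 7 ≡ (8 + d) + (8 + d)
  arith₃ = solve-∀

containsOverlap-prefix : ∀ W Y → ContainsOverlap W → ContainsOverlap (W ++ Y)
containsOverlap-prefix W Y = containsOverlap-infix [] W Y

containsOverlap-suffix : ∀ X W → ContainsOverlap W → ContainsOverlap (X ++ W)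
containsOverlap-suffix X W c = subst ContainsOverlap (cong (X ++_) (++-identityʳ W)) (containsOverlap-infix X W [] c)

module Extremality {U : Word} (F : Framed U) (none : NoOverlap U) where
  open Framed F
  open FramedTwist F
  m = length U

  front : ∀ t a → t ≤ 7 → ContainsOverlap (insert t a (twist U))
  front t a t≤7 = subst ContainsOverlap (sym inserted) (containsOverlap-prefix _ _ (front-insertions first t t≤7 a))
    where
    inserted : insert t a (twist U) ≡ insert t a (twistPre first) ++ flipLast (μ afterPre)
    inserted = trans (cong (insert t a) twist-starts)
                 (insert-++ˡ t a (twistPre first) _ (≤-trans t≤7 (subst (7 ≤_) (sym (length-twistPre first)) (≤ᵇ⇒≤ 7 16 _))))

  back : ∀ t a → m + m ≤ t + 6 → t ≤ m + m → ContainsOverlap (insert t a (twist U))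
  back t a near-end t≤2m with m≤n⇒∃[o]m+o≡n D+10≤t
    where
    D = flipHead (μ beforeSuf)
    D+10≤t : length D + 10 ≤ t
    D+10≤t = +-cancelʳ-≤ 6 _ _ (subst (_≤ t + 6) (trans length-twist-ends (sym (+-assoc (length D) 10 6))) near-end)
  ... | d , D+10+d≡t = subst ContainsOverlap (sym inserted) (containsOverlap-suffix D _ (back-insertions last d d≤6 a))
    where
    D = flipHead (μ beforeSuf)
    position : t ≡ length D + (10 + d)
    position = trans (sym D+10+d≡t) (+-assoc (length D) 10 d)
    d≤6 : d ≤ 6
    d≤6 = +-cancelˡ-≤ 10 d 6 (+-cancelˡ-≤ (length D) _ _ (subst₂ _≤_ position length-twist-ends t≤2m))
    inserted : insert t a (twist U) ≡ D ++ insert (10 + d) a (twistSuf last)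
    inserted = trans (cong₂ (λ n w → insert n a w) position twist-ends) (insert-++ʳ D (10 + d) a (twistSuf last))

  middle : ∀ t a → 8 ≤ t → t + 7 ≤ m + m → ContainsOverlap (insert t a (twist U))
  middle t a 8≤t fits with interior-position t m 8≤t fits
  ... | j , t₀ , refl , j≥1 , j+5<m , t₀∈ = middle-insertion U none j t₀ a j≥1 j+5<m t₀∈

  insertion : ∀ t a → t ≤ m + m → ContainsOverlap (insert t a (twist U))
  insertion t a t≤2m with t ≤? 7 | m + m ≤? t + 6
  ... | yes t≤7 | _           = front t a t≤7
  ... | no _    | yes near-end = back t a near-end t≤2m
  ... | no t≰7  | no ¬near-end = middle t a (≰⇒> t≰7) (subst (_≤ m + m) (sym (+-suc t 6)) (≰⇒> ¬near-end))

  extremal : ExtremalOverlapFree (twist U)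
  extremal = noOverlap⇒overlapFree (twist U) (noOverlap-twist none) , extensions
    where
    extensions : ∀ e → Extension e (twist U) → ContainsOverlap e
    extensions e (w′ , w″ , a , w′w″≡ , refl) =
      subst ContainsOverlap (trans (cong (insert (length w′) a) (sym w′w″≡)) (insert-split w′ w″ a)) (insertion (length w′) a bound)
      where
      bound : length w′ ≤ m + m
      bound = subst (length w′ ≤_) (trans (sym (length-++ w′)) (trans (cong length w′w″≡) (length-twist U))) (m≤m+n _ _)

2*m≡m+m : ∀ m → 2 * m ≡ m + m
2*m≡m+m m = cong (m +_) (+-identityʳ m)

corollary2p6 : (n : ℕ) → 20 ≤ n → (∃ λ m → n ≡ 2 * m) → ¬ IsPowerOfTwo n →
    ∃ λ w → length w ≡ n × ExtremalOverlapFree w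
corollary2p6 n 20≤n (m , refl) np
  with framed-word m (halve-≤ (subst (20 ≤_) (2*m≡m+m m) 20≤n)) (np ∘ subst IsPowerOfTwo (sym (2*m≡m+m m)) ∘ pow2-double m)
... | U , length-U , framed , none =
  twist U , trans (length-twist U) (trans (cong₂ _+_ length-U length-U) (sym (2*m≡m+m m))) , Extremality.extremal framed none
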